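{- Let $f,g\in\mathbb{Z}[x]$ be monic polynomials that are relatively prime over $\mathbb{Q}$, and let $a,b\in\mathbb{Q}[x]$ be the unique polynomials with $a f+b g=1$, $\deg a<\deg g$, $\deg b<\deg f$. If all coefficients of $a$ and $b$ are dyadic, then $f$ and $g$ dyadically resolve.
   Context: A rational number is \emph{dyadic} if it can be written as $c/2^m$ with $c\in\mathbb{Z}$ and $m\ge0$ an integer. Two polynomials with integer coefficients \emph{dyadically resolve} if their resultant (over $\mathbb{Q}$) equals $\pm 2^m$ for some nonnegative integer $m$. -}

module Defs where

open import Data.Nat as ℕ using (ℕ; zero; suc; _∸_; _<ᵇ_; _≤ᵇ_)
open import Data.Nat.Properties using (m^n≢0)
open import Data.Integer as ℤ using (ℤ; +_)
open import Data.Rational as ℚ using (ℚ; 0ℚ; 1ℚ)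
open import Data.Bool using (if_then_else_)
open import Data.List using (List; []; _∷_; _++_; map; [_])
open import Data.Vec as Vec using (Vec)
open import Data.Fin using (Fin; toℕ; punchIn) renaming (zero to fzero; suc to fsuc)
open import Data.Product using (Σ; _×_)
open import Data.Sum using (_⊎_)
open import Relation.Binary.PropositionalEquality using (_≡_)

-- Polynomials as coefficient lists, lowest degree first
-- (trailing zeros allowed; equality is coefficientwise).

coeff : {A : Set} → A → List A → ℕ → A
coeff z []       _       = z
coeff z (c ∷ cs) zero    = c
coeff z (c ∷ cs) (suc k) = coeff z cs k

PolyQ : Set
PolyQ = List ℚ

addQ : PolyQ → PolyQ → PolyQ
addQ []       q        = q
addQ (p ∷ ps) []       = p ∷ ps
addQ (p ∷ ps) (q ∷ qs) = (p ℚ.+ q) ∷ addQ ps qs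

scaleQ : ℚ → PolyQ → PolyQ
scaleQ c = map (c ℚ.*_)

mulQ : PolyQ → PolyQ → PolyQ
mulQ []       q = []
mulQ (p ∷ ps) q = addQ (scaleQ p q) (0ℚ ∷ mulQ ps q)

_≈P_ : PolyQ → PolyQ → Set
p ≈P q = ∀ k → coeff 0ℚ p k ≡ coeff 0ℚ q k

_∣P_ : PolyQ → PolyQ → Set
d ∣P p = Σ PolyQ (λ q → mulQ q d ≈P p)

IsConstant : PolyQ → Set
IsConstant d = ∀ k → coeff 0ℚ d (suc k) ≡ 0ℚ

-- relatively prime over ℚ: every common divisor is a constant (a unit,
-- since a common divisor of nonzero polynomials is nonzero)
RelPrimeQ : PolyQ → PolyQ → Set
RelPrimeQ f g = ∀ d → d ∣P f → d ∣P g → IsConstant d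

-- Monic integer polynomial of degree n:  x^n + c_{n-1} x^{n-1} + … + c_0,
-- given by the vector (c_0 , … , c_{n-1}) of lower coefficients.

MonicZ : ℕ → Set
MonicZ n = Vec ℤ n

coeffsZ : ∀ {n} → MonicZ n → List ℤ
coeffsZ cs = Vec.toList cs ++ [ + 1 ]

toQ : ∀ {n} → MonicZ n → PolyQ
toQ cs = map (λ z → z ℚ./ 1) (coeffsZ cs)

sumFin : ∀ n → (Fin n → ℤ) → ℤ
sumFin zero    h = + 0
sumFin (suc n) h = h fzero ℤ.+ sumFin n (λ i → h (fsuc i))

sgn : ℕ → ℤ
sgn zero    = + 1
sgn (suc k) = ℤ.- sgn k

det : ∀ n → (Fin n → Fin n → ℤ) → ℤ
det zero    M = + 1
det (suc n) M =
  sumFin (suc n) (λ j → sgn (toℕ j) ℤ.* M fzero j ℤ.* det n (λ r c → M (fsuc r) (punchIn j c)))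

-- Sylvester matrix of f (degree n) and g (degree m), size (m + n):
-- rows 0..m-1 hold the coefficients of f (highest first), shifted;
-- rows m..m+n-1 hold the coefficients of g (highest first), shifted.

sylvester : ∀ {n m} → MonicZ n → MonicZ m → Fin (m ℕ.+ n) → Fin (m ℕ.+ n) → ℤ
sylvester {n} {m} f g r c =
  let i = toℕ r ; j = toℕ c in
  if i <ᵇ m
    then (if (i ≤ᵇ j) Data.Bool.∧ ((j ∸ i) ≤ᵇ n)
            then coeff (+ 0) (coeffsZ f) (n ∸ (j ∸ i)) else + 0)
    else (let i' = i ∸ m in
          if (i' ≤ᵇ j) Data.Bool.∧ ((j ∸ i') ≤ᵇ m)
            then coeff (+ 0) (coeffsZ g) (m ∸ (j ∸ i')) else + 0)
  where import Data.Bool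

resultant : ∀ {n m} → MonicZ n → MonicZ m → ℤ
resultant {n} {m} f g = det (m ℕ.+ n) (sylvester f g)

Dyadic : ℚ → Set
Dyadic q = Σ ℤ (λ c → Σ ℕ (λ k → q ≡ (c ℚ./ (2 ℕ.^ k)) {{m^n≢0 2 k}}))

AllDyadic : PolyQ → Set
AllDyadic p = ∀ k → Dyadic (coeff 0ℚ p k)

DyadicallyResolve : ∀ {n m} → MonicZ n → MonicZ m → Set
DyadicallyResolve f g =
  Σ ℕ (λ e → (resultant f g ≡ + (2 ℕ.^ e)) ⊎ (resultant f g ≡ ℤ.- (+ (2 ℕ.^ e))))

-- polynomial of degree < d (zero polynomial included): a coefficient vector of length d
vecQ : ∀ {d} → Vec ℚ d → PolyQ
vecQ = Vec.toList

-- Clearing the power-of-two denominators of a and b gives integer polynomials A, B with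
-- A·f + B·g = 2^E. Since f and g are monic, the step (u, v) ↦ (x·u − t·g, x·v + t·f), with t the
-- top coefficient of u, multiplies u·f + v·g by x without leaving ℤ and keeps deg u < m, deg v < n;
-- so for every d < m + n there are integer u_d, v_d with u_d·f + v_d·g = 2^E·x^d. Their coefficient
-- vectors form a matrix T with T·S = 2^E·I for the Sylvester matrix S, hence
-- det T · Res(f, g) = 2^(E(m+n)) and Res(f, g) = ±2^e.
-- Multiplicativity of the Laplace-expansion determinant comes from the uniqueness of alternating
-- forms: M ↦ det(T·M) − det T · det M is multilinear and alternating in the columns and vanishes
-- at I, hence everywhere.

module Submission where

open import Defs
open import Data.Nat as ℕ using (ℕ; zero; suc; z≤n; s≤s; _∸_; _⊔_; _≤ᵇ_; _<ᵇ_)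
import Data.Nat.Properties as ℕP
import Data.Nat.Tactic.RingSolver as ℕSolver
open import Data.Nat.Divisibility using (_∣_; divides; _∣?_; ∣1⇒≡1; *-cancelʳ-∣)
open import Data.Nat.Primality using (prime[2]; euclidsLemma)
open import Data.Nat.GeneralisedArithmetic using (fold)
open import Data.Integer as ℤ using (ℤ; +_; -[1+_]; _+_; _*_; -_; _-_; 0ℤ; 1ℤ; _^_; ∣_∣)
import Data.Integer.Properties as ℤP
open import Data.Integer.Tactic.RingSolver using (solve-∀)
open import Data.Rational as ℚ using (ℚ; 0ℚ; 1ℚ; toℚᵘ)
import Data.Rational.Properties as ℚP
import Data.Rational.Unnormalised as ℚᵘ
import Data.Rational.Unnormalised.Properties as ℚᵘP
open import Algebra.Bundles using (AbelianGroup)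
open import Algebra.Properties.CommutativeSemigroup ℤP.+-commutativeSemigroup using (interchange)
import Algebra.Properties.CommutativeSemigroup ℤP.*-commutativeSemigroup as ℤ*
import Algebra.Properties.CommutativeSemigroup ℕP.+-commutativeSemigroup as ℕ+
import Algebra.Properties.Group (AbelianGroup.group ℤP.+-0-abelianGroup) as ℤ-group
open import Data.Bool using (true; false; if_then_else_; _∧_)
open import Data.Fin using (Fin; toℕ; fromℕ<; punchIn; punchOut; _↑ˡ_; _↑ʳ_) renaming (zero to fzero; suc to fsuc)
open import Data.Fin.Properties as FinP
  using (_≟_; toℕ-injective; toℕ<n; toℕ-fromℕ<; toℕ-↑ˡ; toℕ-↑ʳ; all?; ¬∀⟶∃¬)
  using (punchIn-injective; punchInᵢ≢i; punchIn-punchOut)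
open import Data.List using (List; []; _∷_; map; length; [_])
open import Data.Vec using (Vec; []; _∷_)
import Data.Vec.Properties as VecP
open import Data.Vec.Functional using (_++_)
open import Data.Vec.Functional.Properties using (lookup-++ˡ; lookup-++ʳ)
open import Data.Product using (Σ; ∃; _×_; _,_; proj₁; proj₂)
open import Data.Sum using (_⊎_; inj₁; inj₂)
open import Data.Empty using (⊥-elim)
open import Function using (_∘_)
open import Relation.Binary using (tri<; tri≈; tri>)
open import Relation.Binary.PropositionalEquality hiding ([_])
open import Relation.Nullary using (Dec; yes; no; does)
open import Relation.Nullary.Decidable using (_→-dec_)
open import Relation.Nullary.Reflects using (ofʸ; ofⁿ)

-- Determinants

sumFin-cong : ∀ n {h h′ : Fin n → ℤ} → (∀ i → h i ≡ h′ i) → sumFin n h ≡ sumFin n h′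
sumFin-cong zero    e = refl
sumFin-cong (suc n) e = cong₂ _+_ (e fzero) (sumFin-cong n (e ∘ fsuc))

sumFin-+ : ∀ n (h k : Fin n → ℤ) → sumFin n (λ i → h i + k i) ≡ sumFin n h + sumFin n k
sumFin-+ zero    h k = refl
sumFin-+ (suc n) h k rewrite sumFin-+ n (h ∘ fsuc) (k ∘ fsuc) =
  interchange (h fzero) (k fzero) (sumFin n (h ∘ fsuc)) (sumFin n (k ∘ fsuc))

*-distribˡ-sumFin : ∀ n t (h : Fin n → ℤ) → t * sumFin n h ≡ sumFin n (λ i → t * h i)
*-distribˡ-sumFin zero    t h = ℤP.*-zeroʳ t
*-distribˡ-sumFin (suc n) t h rewrite sym (*-distribˡ-sumFin n t (h ∘ fsuc)) =
  ℤP.*-distribˡ-+ t (h fzero) _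

sumFin-zero : ∀ n {h : Fin n → ℤ} → (∀ i → h i ≡ 0ℤ) → sumFin n h ≡ 0ℤ
sumFin-zero zero    e = refl
sumFin-zero (suc n) e rewrite e fzero | sumFin-zero n (e ∘ fsuc) = refl

sumFin-single : ∀ n (h : Fin n → ℤ) i → (∀ j → j ≢ i → h j ≡ 0ℤ) → sumFin n h ≡ h i
sumFin-single (suc n) h fzero e
  rewrite sumFin-zero n {h ∘ fsuc} (λ j → e (fsuc j) (λ ())) = ℤP.+-identityʳ (h fzero)
sumFin-single (suc n) h (fsuc i) e
  rewrite e fzero (λ ()) | sumFin-single n (h ∘ fsuc) i (λ j j≢i → e (fsuc j) (j≢i ∘ FinP.suc-injective))
  = ℤP.+-identityˡ _

sumFin-pair : ∀ n (h : Fin n → ℤ) c d → c ≢ d → (∀ j → j ≢ c → j ≢ d → h j ≡ 0ℤ) →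
              sumFin n h ≡ h c + h d
sumFin-pair (suc n) h fzero    fzero    c≢d e = ⊥-elim (c≢d refl)
sumFin-pair (suc n) h fzero    (fsuc d) c≢d e
  rewrite sumFin-single n (h ∘ fsuc) d (λ j j≢d → e (fsuc j) (λ ()) (j≢d ∘ FinP.suc-injective)) = refl
sumFin-pair (suc n) h (fsuc c) fzero    c≢d e
  rewrite sumFin-single n (h ∘ fsuc) c (λ j j≢c → e (fsuc j) (j≢c ∘ FinP.suc-injective) (λ ())) =
  ℤP.+-comm (h fzero) (h (fsuc c))
sumFin-pair (suc n) h (fsuc c) (fsuc d) c≢d e
  rewrite e fzero (λ ()) (λ ())
        | sumFin-pair n (h ∘ fsuc) c d (c≢d ∘ cong fsuc)
            (λ j j≢c j≢d → e (fsuc j) (j≢c ∘ FinP.suc-injective) (j≢d ∘ FinP.suc-injective))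
  = ℤP.+-identityˡ _

sumFin-↑ : ∀ m n (h : Fin (m ℕ.+ n) → ℤ) →
           sumFin (m ℕ.+ n) h ≡ sumFin m (λ i → h (i ↑ˡ n)) + sumFin n (λ i → h (m ↑ʳ i))
sumFin-↑ zero    n h = sym (ℤP.+-identityˡ _)
sumFin-↑ (suc m) n h rewrite sumFin-↑ m n (h ∘ fsuc) = sym (ℤP.+-assoc (h fzero) _ _)

toℕ-punchIn-< : ∀ {n} (i : Fin (suc n)) (j : Fin n) → toℕ j ℕ.< toℕ i → toℕ (punchIn i j) ≡ toℕ j
toℕ-punchIn-< (fsuc i) fzero    _       = refl
toℕ-punchIn-< (fsuc i) (fsuc j) (s≤s p) = cong suc (toℕ-punchIn-< i j p)

toℕ-punchIn-≥ : ∀ {n} (i : Fin (suc n)) (j : Fin n) → toℕ i ℕ.≤ toℕ j → toℕ (punchIn i j) ≡ suc (toℕ j)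
toℕ-punchIn-≥ fzero    j        _       = refl
toℕ-punchIn-≥ (fsuc i) (fsuc j) (s≤s p) = cong suc (toℕ-punchIn-≥ i j p)

toℕ-punchOut-< : ∀ {n} {i j : Fin (suc n)} (i≢j : i ≢ j) → toℕ j ℕ.< toℕ i → toℕ (punchOut i≢j) ≡ toℕ j
toℕ-punchOut-< {suc n} {fsuc i} {fzero}  _   _       = refl
toℕ-punchOut-< {suc n} {fsuc i} {fsuc j} i≢j (s≤s q) = cong suc (toℕ-punchOut-< (i≢j ∘ cong fsuc) q)

toℕ-punchOut-> : ∀ {n} {i j : Fin (suc n)} (i≢j : i ≢ j) → toℕ i ℕ.< toℕ j → suc (toℕ (punchOut i≢j)) ≡ toℕ j
toℕ-punchOut-> {n}     {fzero}  {fsuc j} _   _       = refl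
toℕ-punchOut-> {suc n} {fsuc i} {fsuc j} i≢j (s≤s q) = cong suc (toℕ-punchOut-> (i≢j ∘ cong fsuc) q)

Adjacent : ∀ {n} → Fin n → Fin n → Set
Adjacent c d = toℕ d ≡ suc (toℕ c)

Mat : ℕ → Set
Mat n = Fin n → Fin n → ℤ

minor : ∀ {n} → Fin (suc n) → Mat (suc n) → Mat n
minor j M r c = M (fsuc r) (punchIn j c)

laplaceTerm : ∀ n → Mat (suc n) → Fin (suc n) → ℤ
laplaceTerm n M j = sgn (toℕ j) * M fzero j * det n (minor j M)

AgreeOff : ∀ {n} → Fin n → Mat n → Mat n → Set
AgreeOff c A B = ∀ r c′ → c′ ≢ c → A r c′ ≡ B r c′

det-cong : ∀ n {M M′ : Mat n} → (∀ r c → M r c ≡ M′ r c) → det n M ≡ det n M′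
det-cong zero    e = refl
det-cong (suc n) e = sumFin-cong (suc n) λ j →
  cong₂ (λ a b → sgn (toℕ j) * a * b) (e fzero j) (det-cong n (λ r c → e (fsuc r) (punchIn j c)))

minor-agree : ∀ {n} {A C : Mat (suc n)} j → AgreeOff j A C → ∀ r x → minor j A r x ≡ minor j C r x
minor-agree j agree r x = agree (fsuc r) (punchIn j x) (punchInᵢ≢i j x)

minor-agreeOff : ∀ {n} {A C : Mat (suc n)} {j c} (j≢c : j ≢ c) →
                 AgreeOff c A C → AgreeOff (punchOut j≢c) (minor j A) (minor j C)
minor-agreeOff {j = j} j≢c agree r x x≢ =
  agree (fsuc r) (punchIn j x) λ eq → x≢ (punchIn-injective j x _ (trans eq (sym (punchIn-punchOut j≢c))))

minor-punchOut : ∀ {n} (M : Mat (suc n)) {j c} (j≢c : j ≢ c) r → minor j M r (punchOut j≢c) ≡ M (fsuc r) c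
minor-punchOut M j≢c r = cong (M (fsuc r)) (punchIn-punchOut j≢c)

det-column-+ : ∀ n (A B C : Mat n) c → (∀ r → C r c ≡ A r c + B r c) →
               AgreeOff c A C → AgreeOff c B C → det n C ≡ det n A + det n B
det-column-+ (suc n) A B C c eC eA eB =
  trans (sumFin-cong (suc n) term-+) (sumFin-+ (suc n) (laplaceTerm n A) (laplaceTerm n B))
  where
  term-+ : ∀ j → laplaceTerm n C j ≡ laplaceTerm n A j + laplaceTerm n B j
  term-+ j with j ≟ c
  ... | yes refl
    rewrite eC fzero | det-cong n (minor-agree j eA) | det-cong n (minor-agree j eB) =
    trans (cong (_* det n (minor j C)) (ℤP.*-distribˡ-+ (sgn (toℕ j)) (A fzero j) (B fzero j)))
          (ℤP.*-distribʳ-+ (det n (minor j C)) (sgn (toℕ j) * A fzero j) (sgn (toℕ j) * B fzero j))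
  ... | no j≢c
    rewrite det-column-+ n (minor j A) (minor j B) (minor j C) (punchOut j≢c)
              (λ r → trans (minor-punchOut C j≢c r)
                       (trans (eC (fsuc r)) (sym (cong₂ _+_ (minor-punchOut A j≢c r) (minor-punchOut B j≢c r)))))
              (minor-agreeOff j≢c eA) (minor-agreeOff j≢c eB)
          | eA fzero j j≢c | eB fzero j j≢c =
    ℤP.*-distribˡ-+ (sgn (toℕ j) * C fzero j) _ _

det-column-* : ∀ n (A C : Mat n) c t → (∀ r → C r c ≡ t * A r c) →
               AgreeOff c A C → det n C ≡ t * det n A
det-column-* (suc n) A C c t eC eA =
  trans (sumFin-cong (suc n) term-*) (sym (*-distribˡ-sumFin (suc n) t (laplaceTerm n A)))
  where
  term-* : ∀ j → laplaceTerm n C j ≡ t * laplaceTerm n A j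
  term-* j with j ≟ c
  ... | yes refl rewrite eC fzero | det-cong n (minor-agree j eA) =
    solve-∀-lemma (sgn (toℕ j)) t (A fzero j) (det n (minor j C))
    where solve-∀-lemma : ∀ s t a d → s * (t * a) * d ≡ t * (s * a * d)
          solve-∀-lemma = solve-∀
  ... | no j≢c
    rewrite det-column-* n (minor j A) (minor j C) (punchOut j≢c) t
              (λ r → trans (minor-punchOut C j≢c r)
                       (trans (eC (fsuc r)) (cong (t *_) (sym (minor-punchOut A j≢c r)))))
              (minor-agreeOff j≢c eA)
          | eA fzero j j≢c =
    solve-∀-lemma (sgn (toℕ j)) t (C fzero j) (det n (minor j A))
    where solve-∀-lemma : ∀ s t a d → s * a * (t * d) ≡ t * (s * a * d)
          solve-∀-lemma = solve-∀

adjacent⇒≢ : ∀ {n} {c d : Fin n} → Adjacent c d → c ≢ d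
adjacent⇒≢ {c = c} d≡1+c c≡d = ℕP.<-irrefl (trans (cong toℕ c≡d) d≡1+c) (ℕP.n<1+n (toℕ c))

punchOut-adjacent : ∀ {n} {j c d : Fin (suc n)} (j≢c : j ≢ c) (j≢d : j ≢ d) →
                    Adjacent c d → Adjacent (punchOut j≢c) (punchOut j≢d)
punchOut-adjacent {j = j} {c} {d} j≢c j≢d d≡1+c with ℕP.<-cmp (toℕ j) (toℕ c)
... | tri< j<c _ _ = ℕP.suc-injective (begin
  suc (toℕ (punchOut j≢d))
    ≡⟨ toℕ-punchOut-> j≢d (ℕP.<-trans j<c (subst (toℕ c ℕ.<_) (sym d≡1+c) (ℕP.n<1+n _))) ⟩
  toℕ d
    ≡⟨ d≡1+c ⟩
  suc (toℕ c)
    ≡⟨ cong suc (toℕ-punchOut-> j≢c j<c) ⟨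
  suc (suc (toℕ (punchOut j≢c))) ∎)
  where open ≡-Reasoning
... | tri≈ _ j≡c _ = ⊥-elim (j≢c (toℕ-injective j≡c))
... | tri> _ _ c<j = trans (toℕ-punchOut-< j≢d d<j) (trans d≡1+c (cong suc (sym (toℕ-punchOut-< j≢c c<j))))
  where d<j : toℕ d ℕ.< toℕ j
        d<j = ℕP.≤∧≢⇒< (subst (ℕ._≤ toℕ j) (sym d≡1+c) c<j) (λ q → j≢d (toℕ-injective (sym q)))

minor-adjacent : ∀ {n} (M : Mat (suc n)) {c d} → Adjacent c d → (∀ r → M r c ≡ M r d) →
                 ∀ r x → minor c M r x ≡ minor d M r x
minor-adjacent M {c} {d} d≡1+c eM r x with ℕP.<-cmp (toℕ x) (toℕ c)
... | tri< x<c _ _ =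
  cong (M (fsuc r)) (toℕ-injective (trans (toℕ-punchIn-< c x x<c) (sym (toℕ-punchIn-< d x x<d))))
  where x<d = ℕP.<-trans x<c (subst (toℕ c ℕ.<_) (sym d≡1+c) (ℕP.n<1+n _))
... | tri≈ _ x≡c _ = begin
  M (fsuc r) (punchIn c x) ≡⟨ cong (M (fsuc r)) (toℕ-injective (begin
                                toℕ (punchIn c x) ≡⟨ toℕ-punchIn-≥ c x (ℕP.≤-reflexive (sym x≡c)) ⟩
                                suc (toℕ x)       ≡⟨ cong suc x≡c ⟩
                                suc (toℕ c)       ≡⟨ d≡1+c ⟨
                                toℕ d             ∎)) ⟩
  M (fsuc r) d             ≡⟨ eM (fsuc r) ⟨
  M (fsuc r) c             ≡⟨ cong (M (fsuc r)) (toℕ-injective (trans (toℕ-punchIn-< d x x<d) x≡c)) ⟨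
  M (fsuc r) (punchIn d x) ∎
  where open ≡-Reasoning
        x<d : toℕ x ℕ.< toℕ d
        x<d = subst (toℕ x ℕ.<_) (sym d≡1+c) (s≤s (ℕP.≤-reflexive x≡c))
... | tri> _ _ c<x =
  cong (M (fsuc r)) (toℕ-injective (trans (toℕ-punchIn-≥ c x (ℕP.<⇒≤ c<x)) (sym (toℕ-punchIn-≥ d x d≤x))))
  where d≤x : toℕ d ℕ.≤ toℕ x
        d≤x = subst (ℕ._≤ toℕ x) (sym d≡1+c) c<x

-- Expanding along the first row, the two terms at columns c and d cancel (their minors agree and
-- their signs are opposite), and every other minor again has two equal adjacent columns.
det-adjacent : ∀ n (M : Mat n) c d → Adjacent c d → (∀ r → M r c ≡ M r d) → det n M ≡ 0ℤ
det-adjacent (suc n) M c d d≡1+c eM =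
  trans (sumFin-pair (suc n) (laplaceTerm n M) c d (adjacent⇒≢ d≡1+c) others) pair
  where
  others : ∀ j → j ≢ c → j ≢ d → laplaceTerm n M j ≡ 0ℤ
  others j j≢c j≢d = trans (cong (sgn (toℕ j) * M fzero j *_) minor-zero) (ℤP.*-zeroʳ (sgn (toℕ j) * M fzero j))
    where
    minor-zero : det n (minor j M) ≡ 0ℤ
    minor-zero = det-adjacent n (minor j M) (punchOut j≢c) (punchOut j≢d) (punchOut-adjacent j≢c j≢d d≡1+c)
      (λ r → trans (minor-punchOut M j≢c r) (trans (eM (fsuc r)) (sym (minor-punchOut M j≢d r))))
  pair : laplaceTerm n M c + laplaceTerm n M d ≡ 0ℤ
  pair rewrite d≡1+c | sym (eM fzero) | det-cong n (minor-adjacent M d≡1+c eM) =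
    cancel (sgn (toℕ c)) (M fzero c) (det n (minor d M))
    where cancel : ∀ s a b → s * a * b + (- s) * a * b ≡ 0ℤ
          cancel = solve-∀

δ : ℕ → ℕ → ℤ
δ zero    zero    = 1ℤ
δ zero    (suc _) = 0ℤ
δ (suc _) zero    = 0ℤ
δ (suc a) (suc b) = δ a b

δ-refl : ∀ a → δ a a ≡ 1ℤ
δ-refl zero    = refl
δ-refl (suc a) = δ-refl a

δ-≢ : ∀ {a b} → a ≢ b → δ a b ≡ 0ℤ
δ-≢ {zero}  {zero}  a≢b = ⊥-elim (a≢b refl)
δ-≢ {zero}  {suc b} _   = refl
δ-≢ {suc a} {zero}  _   = refl
δ-≢ {suc a} {suc b} a≢b = δ-≢ (a≢b ∘ cong suc)

I : ∀ {n} → Mat n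
I r c = δ (toℕ r) (toℕ c)

I-diagonal : ∀ {n} (r : Fin n) → I r r ≡ 1ℤ
I-diagonal r = δ-refl (toℕ r)

I-offDiagonal : ∀ {n} {r c : Fin n} → r ≢ c → I r c ≡ 0ℤ
I-offDiagonal r≢c = δ-≢ (r≢c ∘ toℕ-injective)

det-scalar : ∀ n t → det n (λ r c → t * I r c) ≡ t ^ n
det-scalar zero    t = refl
det-scalar (suc n) t =
  trans (sumFin-single (suc n) (laplaceTerm n (λ r c → t * I r c)) fzero offDiagonal)
        (trans (cong (1ℤ * (t * 1ℤ) *_) (det-scalar n t)) (normalise t (t ^ n)))
  where
  offDiagonal : ∀ j → j ≢ fzero → laplaceTerm n (λ r c → t * I r c) j ≡ 0ℤ
  offDiagonal fzero    0≢0 = ⊥-elim (0≢0 refl)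
  offDiagonal (fsuc j) _   = vanish (sgn (suc (toℕ j))) t (det n (minor (fsuc j) (λ r c → t * I r c)))
    where vanish : ∀ s t d → s * (t * 0ℤ) * d ≡ 0ℤ
          vanish = solve-∀
  normalise : ∀ t u → 1ℤ * (t * 1ℤ) * u ≡ t * u
  normalise = solve-∀

det-I : ∀ n → det n I ≡ 1ℤ
det-I n = trans (det-cong n (λ r c → sym (ℤP.*-identityˡ (I r c)))) (trans (det-scalar n 1ℤ) (ℤP.^-zeroˡ n))

-- Alternating forms

record IsAlternating (n : ℕ) (Δ : Mat n → ℤ) : Set where
  field
    Δ-cong      : ∀ {M M′} → (∀ r c → M r c ≡ M′ r c) → Δ M ≡ Δ M′
    additive    : ∀ A B C c → (∀ r → C r c ≡ A r c + B r c) → AgreeOff c A C → AgreeOff c B C →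
                  Δ C ≡ Δ A + Δ B
    homogeneous : ∀ A C c t → (∀ r → C r c ≡ t * A r c) → AgreeOff c A C → Δ C ≡ t * Δ A
    alternating : ∀ M c d → Adjacent c d → (∀ r → M r c ≡ M r d) → Δ M ≡ 0ℤ

update : ∀ {n} {A : Set} → (Fin n → A) → Fin n → A → Fin n → A
update σ k v x = if does (x ≟ k) then v else σ x

update-here : ∀ {n} {A : Set} (σ : Fin n → A) k v → update σ k v k ≡ v
update-here σ k v with k ≟ k
... | yes _   = refl
... | no  k≢k = ⊥-elim (k≢k refl)

update-there : ∀ {n} {A : Set} (σ : Fin n → A) k v {x} → x ≢ k → update σ k v x ≡ σ x
update-there σ k v {x} x≢k with x ≟ k
... | yes x≡k = ⊥-elim (x≢k x≡k)
... | no  _   = refl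

setColumn : ∀ {n} → Mat n → Fin n → (Fin n → ℤ) → Mat n
setColumn M c v r = update (M r) c (v r)

sumℕ : ∀ n → (Fin n → ℕ) → ℕ
sumℕ zero    h = 0
sumℕ (suc n) h = h fzero ℕ.+ sumℕ n (h ∘ fsuc)

sumℕ-cong : ∀ n {h h′ : Fin n → ℕ} → (∀ x → h x ≡ h′ x) → sumℕ n h ≡ sumℕ n h′
sumℕ-cong zero    e = refl
sumℕ-cong (suc n) e = cong₂ ℕ._+_ (e fzero) (sumℕ-cong n (e ∘ fsuc))

sumℕ-change : ∀ n (h h′ : Fin n → ℕ) c → (∀ x → x ≢ c → h x ≡ h′ x) →
              sumℕ n h′ ℕ.+ h c ≡ sumℕ n h ℕ.+ h′ c
sumℕ-change (suc n) h h′ fzero e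
  rewrite sumℕ-cong n (λ x → sym (e (fsuc x) (λ ()))) = ℕ+.xy∙z≈zy∙x (h′ fzero) (sumℕ n (h ∘ fsuc)) (h fzero)
sumℕ-change (suc n) h h′ (fsuc c) e
  rewrite e fzero (λ ())
        | ℕP.+-assoc (h′ fzero) (sumℕ n (h′ ∘ fsuc)) (h (fsuc c))
        | ℕP.+-assoc (h′ fzero) (sumℕ n (h ∘ fsuc)) (h′ (fsuc c))
  = cong (h′ fzero ℕ.+_)
         (sumℕ-change n (h ∘ fsuc) (h′ ∘ fsuc) c (λ x x≢c → e (fsuc x) (x≢c ∘ FinP.suc-injective)))

sumℕ-bound : ∀ n (h : Fin n → ℕ) B → (∀ x → h x ℕ.≤ B) → sumℕ n h ℕ.≤ n ℕ.* B
sumℕ-bound zero    h B e = z≤n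
sumℕ-bound (suc n) h B e = ℕP.+-mono-≤ (e fzero) (sumℕ-bound n (h ∘ fsuc) B (e ∘ fsuc))

Ascending : ∀ {n} → (Fin n → Fin n) → Set
Ascending σ = ∀ c d → Adjacent c d → toℕ (σ c) ℕ.< toℕ (σ d)

ascendsAt? : ∀ {n} (σ : Fin n → Fin n) c d → Dec (Adjacent c d → toℕ (σ c) ℕ.< toℕ (σ d))
ascendsAt? σ c d = (toℕ d ℕ.≟ suc (toℕ c)) →-dec (toℕ (σ c) ℕ.<? toℕ (σ d))

ascending-or-descent : ∀ {n} (σ : Fin n → Fin n) →
                       Ascending σ ⊎ ∃ λ c → ∃ λ d → Adjacent c d × toℕ (σ d) ℕ.≤ toℕ (σ c)
ascending-or-descent {n} σ with all? (λ c → all? (ascendsAt? σ c))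
... | yes ascending = inj₁ ascending
... | no ¬ascending with ¬∀⟶∃¬ n _ (λ c → all? (ascendsAt? σ c)) ¬ascending
... | c , ¬ascendsFrom-c with ¬∀⟶∃¬ n _ (ascendsAt? σ c) ¬ascendsFrom-c
... | d , ¬ascendsAt-cd with toℕ d ℕ.≟ suc (toℕ c)
...   | yes adj = inj₂ (c , d , adj , ℕP.≮⇒≥ (λ σc<σd → ¬ascendsAt-cd (λ _ → σc<σd)))
...   | no ¬adj = ⊥-elim (¬ascendsAt-cd (λ adj → ⊥-elim (¬adj adj)))

-- An ascending σ satisfies k ≤ σ x when x = k (counting up from 0) and σ x + j + 1 ≤ n when
-- x + j + 1 = n (counting down from n - 1), hence σ x = x.
ascending⇒id : ∀ {n} (σ : Fin n → Fin n) → Ascending σ → ∀ x → σ x ≡ x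
ascending⇒id {n} σ ascending x = toℕ-injective (ℕP.≤-antisym σx≤x (lower (toℕ x) x refl))
  where
  lower : ∀ k x → toℕ x ≡ k → k ℕ.≤ toℕ (σ x)
  lower zero    x _      = z≤n
  lower (suc k) x x≡1+k = ℕP.≤-<-trans (lower k c (toℕ-fromℕ< k<n))
                            (ascending c x (trans x≡1+k (cong suc (sym (toℕ-fromℕ< k<n)))))
    where
    k<n : k ℕ.< n
    k<n = ℕP.<-trans (ℕP.n<1+n k) (subst (ℕ._< n) x≡1+k (toℕ<n x))
    c = fromℕ< k<n

  upper : ∀ j x → toℕ x ℕ.+ suc j ≡ n → toℕ (σ x) ℕ.+ suc j ℕ.≤ n
  upper zero    x _ = subst (ℕ._≤ n) (ℕP.+-comm 1 (toℕ (σ x))) (toℕ<n (σ x))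
  upper (suc j) x e = ℕP.≤-trans step (upper j d d+1+j≡n)
    where
    1+x+1+j≡n : suc (toℕ x) ℕ.+ suc j ≡ n
    1+x+1+j≡n = trans (sym (ℕP.+-suc (toℕ x) (suc j))) e
    1+x<n : suc (toℕ x) ℕ.< n
    1+x<n = subst (suc (toℕ x) ℕ.<_) 1+x+1+j≡n (ℕP.m<m+n (suc (toℕ x)) (s≤s z≤n))
    d = fromℕ< 1+x<n
    d+1+j≡n : toℕ d ℕ.+ suc j ≡ n
    d+1+j≡n = trans (cong (ℕ._+ suc j) (toℕ-fromℕ< 1+x<n)) 1+x+1+j≡n
    step : toℕ (σ x) ℕ.+ suc (suc j) ℕ.≤ toℕ (σ d) ℕ.+ suc j
    step = subst (ℕ._≤ toℕ (σ d) ℕ.+ suc j) (sym (ℕP.+-suc (toℕ (σ x)) (suc j)))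
             (ℕP.+-monoˡ-≤ (suc j) (ascending x d (toℕ-fromℕ< 1+x<n)))

  σx≤x : toℕ (σ x) ℕ.≤ toℕ x
  σx≤x = ℕP.+-cancelʳ-≤ (suc j) (toℕ (σ x)) (toℕ x)
           (subst (toℕ (σ x) ℕ.+ suc j ℕ.≤_) (sym x+1+j≡n) (upper j x x+1+j≡n))
    where
    j = n ∸ suc (toℕ x)
    x+1+j≡n : toℕ x ℕ.+ suc j ≡ n
    x+1+j≡n = trans (ℕP.+-suc (toℕ x) j) (ℕP.m+[n∸m]≡n (toℕ<n x))

weight : ∀ {n} → (Fin n → Fin n) → ℕ
weight {n} σ = sumℕ n (λ x → toℕ x ℕ.* toℕ (σ x))

weight-bound : ∀ {n} (σ : Fin n → Fin n) → weight σ ℕ.≤ n ℕ.* (n ℕ.* n)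
weight-bound {n} σ =
  sumℕ-bound n _ (n ℕ.* n) (λ x → ℕP.*-mono-≤ (ℕP.<⇒≤ (toℕ<n x)) (ℕP.<⇒≤ (toℕ<n (σ x))))

swapValues : ∀ {n} → (Fin n → Fin n) → Fin n → Fin n → Fin n → Fin n
swapValues σ c d = update (update σ c (σ d)) d (σ c)

-- Exchanging the values at c and d = c + 1 changes the weight by σ c − σ d.
weight-swapValues : ∀ {n} (σ : Fin n → Fin n) {c d} → Adjacent c d → toℕ (σ d) ℕ.< toℕ (σ c) →
                    weight σ ℕ.< weight (swapValues σ c d)
weight-swapValues {n} σ {c} {d} d≡1+c σd<σc =
  ℕP.+-cancelʳ-< (toℕ (σ c)) (weight σ) (weight σ″)
    (subst (ℕ._< weight σ″ ℕ.+ toℕ (σ c))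
           (balance (weight σ″) (weight σ′) (weight σ) (toℕ c) (toℕ (σ c)) (toℕ (σ d)) first second)
       (ℕP.+-monoʳ-< (weight σ″) σd<σc))
  where
  σ′ = update σ c (σ d)
  σ″ = update σ′ d (σ c)
  term : (Fin n → Fin n) → Fin n → ℕ
  term τ x = toℕ x ℕ.* toℕ (τ x)

  first : weight σ′ ℕ.+ toℕ c ℕ.* toℕ (σ c) ≡ weight σ ℕ.+ toℕ c ℕ.* toℕ (σ d)
  first = trans (sumℕ-change n (term σ) (term σ′) c
                  (λ x x≢c → cong (λ z → toℕ x ℕ.* toℕ z) (sym (update-there σ c (σ d) x≢c))))
                (cong (λ z → weight σ ℕ.+ toℕ c ℕ.* toℕ z) (update-here σ c (σ d)))

  second : weight σ″ ℕ.+ suc (toℕ c) ℕ.* toℕ (σ d) ≡ weight σ′ ℕ.+ suc (toℕ c) ℕ.* toℕ (σ c)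
  second = subst (λ t → weight σ″ ℕ.+ t ℕ.* toℕ (σ d) ≡ weight σ′ ℕ.+ t ℕ.* toℕ (σ c)) d≡1+c
    (trans (cong (λ z → weight σ″ ℕ.+ toℕ d ℕ.* toℕ z) (sym (update-there σ c (σ d) (adjacent⇒≢ d≡1+c ∘ sym))))
      (trans (sumℕ-change n (term σ′) (term σ″) d
                (λ x x≢d → cong (λ z → toℕ x ℕ.* toℕ z) (sym (update-there σ′ d (σ c) x≢d))))
        (cong (λ z → weight σ′ ℕ.+ toℕ d ℕ.* toℕ z) (update-here σ′ d (σ c)))))

  balance : ∀ w″ w′ w c sc sd → w′ ℕ.+ c ℕ.* sc ≡ w ℕ.+ c ℕ.* sd →
            w″ ℕ.+ suc c ℕ.* sd ≡ w′ ℕ.+ suc c ℕ.* sc → w″ ℕ.+ sd ≡ w ℕ.+ sc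
  balance w″ w′ w c sc sd e₁ e₂ =
    ℕP.+-cancelʳ-≡ (w′ ℕ.+ c ℕ.* sc ℕ.+ c ℕ.* sd) (w″ ℕ.+ sd) (w ℕ.+ sc) (begin
    w″ ℕ.+ sd ℕ.+ (w′ ℕ.+ c ℕ.* sc ℕ.+ c ℕ.* sd)  ≡⟨ regroup₁ w″ w′ c sc sd ⟩
    (w″ ℕ.+ suc c ℕ.* sd) ℕ.+ (w′ ℕ.+ c ℕ.* sc)   ≡⟨ cong₂ ℕ._+_ e₂ e₁ ⟩
    (w′ ℕ.+ suc c ℕ.* sc) ℕ.+ (w ℕ.+ c ℕ.* sd)    ≡⟨ regroup₂ w′ w c sc sd ⟩
    w ℕ.+ sc ℕ.+ (w′ ℕ.+ c ℕ.* sc ℕ.+ c ℕ.* sd)   ∎)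
    where
    open ≡-Reasoning
    regroup₁ : ∀ w″ w′ c sc sd →
               w″ ℕ.+ sd ℕ.+ (w′ ℕ.+ c ℕ.* sc ℕ.+ c ℕ.* sd) ≡ (w″ ℕ.+ suc c ℕ.* sd) ℕ.+ (w′ ℕ.+ c ℕ.* sc)
    regroup₁ = ℕSolver.solve-∀
    regroup₂ : ∀ w′ w c sc sd →
               (w′ ℕ.+ suc c ℕ.* sc) ℕ.+ (w ℕ.+ c ℕ.* sd) ≡ w ℕ.+ sc ℕ.+ (w′ ℕ.+ c ℕ.* sc ℕ.+ c ℕ.* sd)
    regroup₂ = ℕSolver.solve-∀

basisColumns : ∀ {n} → (Fin n → Fin n) → Mat n
basisColumns σ r x = I r (σ x)

module _ {N : ℕ} {Δ : Mat N → ℤ} (Δ-alternating : IsAlternating N Δ) where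
  open IsAlternating Δ-alternating

  twoColumns : Mat N → Fin N → Fin N → (Fin N → ℤ) → (Fin N → ℤ) → Mat N
  twoColumns M c d p q = setColumn (setColumn M c p) d q

  private
    twoColumns-c : ∀ M {c d} → c ≢ d → ∀ p q r → twoColumns M c d p q r c ≡ p r
    twoColumns-c M {c} {d} c≢d p q r = trans (update-there (setColumn M c p r) d (q r) c≢d) (update-here (M r) c (p r))

    twoColumns-d : ∀ M {c d} p q r → twoColumns M c d p q r d ≡ q r
    twoColumns-d M {c} {d} p q r = update-here (setColumn M c p r) d (q r)

    twoColumns-agreeOff-c : ∀ M {c d} p p′ q → AgreeOff c (twoColumns M c d p q) (twoColumns M c d p′ q)
    twoColumns-agreeOff-c M {c} {d} p p′ q r x x≢c with x ≟ d
    ... | yes _ = refl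
    ... | no  _ = trans (update-there (M r) c (p r) x≢c) (sym (update-there (M r) c (p′ r) x≢c))

    twoColumns-agreeOff-d : ∀ M {c d} p q q′ → AgreeOff d (twoColumns M c d p q) (twoColumns M c d p q′)
    twoColumns-agreeOff-d M {c} {d} p q q′ r x x≢d =
      trans (update-there (setColumn M c p r) d (q r) x≢d) (sym (update-there (setColumn M c p r) d (q′ r) x≢d))

  -- Expand Δ(p + q, p + q) = 0 by additivity in both columns; the terms Δ(p, p) and Δ(q, q) vanish.
  Δ-antisymmetric : ∀ M {c d} → Adjacent c d → ∀ p q →
                    Δ (twoColumns M c d p q) ≡ - Δ (twoColumns M c d q p)
  Δ-antisymmetric M {c} {d} d≡1+c p q = ℤ-group.inverseˡ-unique (Δ (U p q)) (Δ (U q p)) (begin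
    Δ (U p q) + Δ (U q p)
      ≡⟨ cong₂ _+_ (ℤP.+-identityˡ (Δ (U p q))) (ℤP.+-identityʳ (Δ (U q p))) ⟨
    (0ℤ + Δ (U p q)) + (Δ (U q p) + 0ℤ)
      ≡⟨ cong₂ (λ a b → (a + Δ (U p q)) + (Δ (U q p) + b)) (equal p) (equal q) ⟨
    (Δ (U p p) + Δ (U p q)) + (Δ (U q p) + Δ (U q q))
      ≡⟨ cong₂ _+_ (additive-d p p q) (additive-d q p q) ⟨
    Δ (U p (p ⊕ q)) + Δ (U q (p ⊕ q))
      ≡⟨ additive-c p q (p ⊕ q) ⟨
    Δ (U (p ⊕ q) (p ⊕ q))
      ≡⟨ equal (p ⊕ q) ⟩
    0ℤ ∎)
    where
    open ≡-Reasoning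
    c≢d = adjacent⇒≢ d≡1+c
    U = twoColumns M c d
    _⊕_ : (Fin N → ℤ) → (Fin N → ℤ) → Fin N → ℤ
    (p ⊕ q) r = p r + q r
    at-c = twoColumns-c M c≢d
    at-d = twoColumns-d M {c} {d}
    equal : ∀ p → Δ (U p p) ≡ 0ℤ
    equal p = alternating (U p p) c d d≡1+c (λ r → trans (at-c p p r) (sym (at-d p p r)))
    additive-c : ∀ p q w → Δ (U (p ⊕ q) w) ≡ Δ (U p w) + Δ (U q w)
    additive-c p q w = additive (U p w) (U q w) (U (p ⊕ q) w) c
      (λ r → trans (at-c (p ⊕ q) w r) (sym (cong₂ _+_ (at-c p w r) (at-c q w r))))
      (twoColumns-agreeOff-c M {c} {d} p (p ⊕ q) w) (twoColumns-agreeOff-c M {c} {d} q (p ⊕ q) w)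
    additive-d : ∀ w p q → Δ (U w (p ⊕ q)) ≡ Δ (U w p) + Δ (U w q)
    additive-d w p q = additive (U w p) (U w q) (U w (p ⊕ q)) d
      (λ r → trans (at-d w (p ⊕ q) r) (sym (cong₂ _+_ (at-d w p r) (at-d w q r))))
      (twoColumns-agreeOff-d M {c} {d} w p (p ⊕ q)) (twoColumns-agreeOff-d M {c} {d} w q (p ⊕ q))

  Δ-swapValues : ∀ σ {c d} → Adjacent c d → Δ (basisColumns σ) ≡ - Δ (basisColumns (swapValues σ c d))
  Δ-swapValues σ {c} {d} d≡1+c =
    trans (Δ-cong before) (trans (Δ-antisymmetric (basisColumns σ) d≡1+c p q) (cong -_ (Δ-cong (λ r x → sym (after r x)))))
    where
    p q : Fin N → ℤ
    p r = I r (σ c)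
    q r = I r (σ d)
    before : ∀ r x → basisColumns σ r x ≡ twoColumns (basisColumns σ) c d p q r x
    before r x with x ≟ d | x ≟ c
    ... | yes refl | _        = refl
    ... | no _     | yes refl = refl
    ... | no _     | no _     = refl
    after : ∀ r x → basisColumns (swapValues σ c d) r x ≡ twoColumns (basisColumns σ) c d q p r x
    after r x with x ≟ d | x ≟ c
    ... | yes refl | _        = refl
    ... | no _     | yes refl = refl
    ... | no _     | no _     = refl

  Δ-columnSum : ∀ K (t : Fin K → ℤ) (v : Fin K → Fin N → ℤ) X c →
                (∀ r → X r c ≡ sumFin K (λ i → t i * v i r)) →
                (∀ i → Δ (setColumn X c (v i)) ≡ 0ℤ) → Δ X ≡ 0ℤ
  Δ-columnSum zero t v X c eX _ =
    trans (homogeneous X X c 0ℤ (λ r → trans (eX r) (sym (ℤP.*-zeroˡ (X r c)))) (λ _ _ _ → refl))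
          (ℤP.*-zeroˡ (Δ X))
  Δ-columnSum (suc K) t v X c eX vanish =
    trans (additive (setColumn X c head) (setColumn X c tail) X c
             (λ r → trans (eX r) (sym (cong₂ _+_ (update-here (X r) c (head r)) (update-here (X r) c (tail r)))))
             (λ r x x≢c → update-there (X r) c (head r) x≢c)
             (λ r x x≢c → update-there (X r) c (tail r) x≢c))
          (trans (cong₂ _+_ head-zero tail-zero) (ℤP.+-identityʳ 0ℤ))
    where
    head tail : Fin N → ℤ
    head r = t fzero * v fzero r
    tail r = sumFin K (λ i → t (fsuc i) * v (fsuc i) r)
    head-zero : Δ (setColumn X c head) ≡ 0ℤ
    head-zero = trans (homogeneous (setColumn X c (v fzero)) (setColumn X c head) c (t fzero)
                         (λ r → trans (update-here (X r) c (head r)) (cong (t fzero *_) (sym (update-here (X r) c (v fzero r)))))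
                         (λ r x x≢c → trans (update-there (X r) c (v fzero r) x≢c) (sym (update-there (X r) c (head r) x≢c))))
                      (trans (cong (t fzero *_) (vanish fzero)) (ℤP.*-zeroʳ (t fzero)))
    tail-zero : Δ (setColumn X c tail) ≡ 0ℤ
    tail-zero = Δ-columnSum K (t ∘ fsuc) (v ∘ fsuc) (setColumn X c tail) c (λ r → update-here (X r) c (tail r))
      (λ i → trans (Δ-cong (λ r x → overwrite (X r) (tail r) (v (fsuc i) r) x)) (vanish (fsuc i)))
      where
      overwrite : ∀ (row : Fin N → ℤ) a b x → update (update row c a) c b x ≡ update row c b x
      overwrite row a b x with x ≟ c
      ... | yes _ = refl
      ... | no  _ = refl

  module _ (Δ-I : Δ I ≡ 0ℤ) where

    -- Bubble sort: swapping the values at an adjacent descent raises the bounded weight.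
    Δ-basisColumns : ∀ σ → Δ (basisColumns σ) ≡ 0ℤ
    Δ-basisColumns σ = sorted (suc B) σ (ℕP.<-≤-trans (ℕP.n<1+n B) (ℕP.m≤n+m (suc B) (weight σ)))
      where
      B = N ℕ.* (N ℕ.* N)
      sorted : ∀ k σ → B ℕ.< weight σ ℕ.+ k → Δ (basisColumns σ) ≡ 0ℤ
      sorted k σ enough with ascending-or-descent σ
      ... | inj₁ ascending = trans (Δ-cong (λ r x → cong (I r) (ascending⇒id σ ascending x))) Δ-I
      ... | inj₂ (c , d , d≡1+c , σd≤σc) with toℕ (σ d) ℕ.≟ toℕ (σ c) | k
      ...   | yes σd≡σc | _ = alternating (basisColumns σ) c d d≡1+c (λ r → cong (I r) (toℕ-injective (sym σd≡σc)))
      ...   | no σd≢σc | zero =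
        ⊥-elim (ℕP.<⇒≱ enough (subst (ℕ._≤ B) (sym (ℕP.+-identityʳ (weight σ))) (weight-bound σ)))
      ...   | no σd≢σc | suc k′ =
        trans (Δ-swapValues σ d≡1+c) (cong -_ (sorted k′ (swapValues σ c d) still-enough))
        where
        still-enough : B ℕ.< weight (swapValues σ c d) ℕ.+ k′
        still-enough = ℕP.<-≤-trans enough
                         (subst (ℕ._≤ weight (swapValues σ c d) ℕ.+ k′) (sym (ℕP.+-suc (weight σ) k′))
                         (ℕP.+-monoˡ-≤ k′ (weight-swapValues σ d≡1+c (ℕP.≤∧≢⇒< σd≤σc σd≢σc))))

    leftColumns : ℕ → Mat N → (Fin N → Fin N) → Mat N
    leftColumns p M σ r c with toℕ c ℕ.<? p
    ... | yes _ = M r c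
    ... | no  _ = I r (σ c)

    -- Column p of M is the combination Σᵢ M i p · eᵢ; replacing it by eᵢ leaves p columns of M.
    Δ-leftColumns : ∀ M p → p ℕ.≤ N → ∀ σ → Δ (leftColumns p M σ) ≡ 0ℤ
    Δ-leftColumns M zero    _   σ = trans (Δ-cong none) (Δ-basisColumns σ)
      where none : ∀ r c → leftColumns zero M σ r c ≡ basisColumns σ r c
            none r c with toℕ c ℕ.<? zero
            ... | no _ = refl
    Δ-leftColumns M (suc p) p<N σ =
      Δ-columnSum N (λ i → M i c₀) (λ i r → I r i) (leftColumns (suc p) M σ) c₀ expand replaced
      where
      c₀ = fromℕ< p<N
      c₀≡p : toℕ c₀ ≡ p
      c₀≡p = toℕ-fromℕ< p<N
      expand : ∀ r → leftColumns (suc p) M σ r c₀ ≡ sumFin N (λ i → M i c₀ * I r i)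
      expand r = trans taken (sym (trans (sumFin-single N _ r offDiagonal)
                                   (trans (cong (M r c₀ *_) (I-diagonal r)) (ℤP.*-identityʳ (M r c₀)))))
        where
        taken : leftColumns (suc p) M σ r c₀ ≡ M r c₀
        taken with toℕ c₀ ℕ.<? suc p
        ... | yes _   = refl
        ... | no  c≮p = ⊥-elim (c≮p (s≤s (ℕP.≤-reflexive c₀≡p)))
        offDiagonal : ∀ i → i ≢ r → M i c₀ * I r i ≡ 0ℤ
        offDiagonal i i≢r = trans (cong (M i c₀ *_) (I-offDiagonal (i≢r ∘ sym))) (ℤP.*-zeroʳ (M i c₀))
      replaced : ∀ i → Δ (setColumn (leftColumns (suc p) M σ) c₀ (λ r → I r i)) ≡ 0ℤ
      replaced i = trans (Δ-cong same) (Δ-leftColumns M p (ℕP.<⇒≤ p<N) (update σ c₀ i))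
        where
        same : ∀ r x → setColumn (leftColumns (suc p) M σ) c₀ (λ r → I r i) r x ≡ leftColumns p M (update σ c₀ i) r x
        same r x with x ≟ c₀
        same r x | yes x≡c₀ with toℕ x ℕ.<? p
        ... | yes x<p = ⊥-elim (ℕP.<-irrefl (trans (cong toℕ x≡c₀) c₀≡p) x<p)
        ... | no  _   = cong (I r) (sym (trans (cong (update σ c₀ i) x≡c₀) (update-here σ c₀ i)))
        same r x | no x≢c₀ with toℕ x ℕ.<? suc p | toℕ x ℕ.<? p
        ... | yes _   | yes _   = refl
        ... | no  _   | no  _   = cong (I r) (sym (update-there σ c₀ i x≢c₀))
        ... | yes x<1+p | no x≮p =
          ⊥-elim (x≢c₀ (toℕ-injective (trans (ℕP.≤-antisym (ℕP.≤-pred x<1+p) (ℕP.≮⇒≥ x≮p)) (sym c₀≡p))))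
        ... | no x≮1+p | yes x<p = ⊥-elim (x≮1+p (ℕP.<-trans x<p (ℕP.n<1+n p)))

    Δ-vanishes : ∀ M → Δ M ≡ 0ℤ
    Δ-vanishes M = trans (Δ-cong all) (Δ-leftColumns M N ℕP.≤-refl (λ x → x))
      where all : ∀ r c → M r c ≡ leftColumns N M (λ x → x) r c
            all r c with toℕ c ℕ.<? N
            ... | yes _   = refl
            ... | no  c≮N = ⊥-elim (c≮N (toℕ<n c))

-- Multiplicativity of the determinant

_·_ : ∀ {n} → Mat n → Mat n → Mat n
_·_ {n} T M r c = sumFin n (λ k → T r k * M k c)

module _ (N : ℕ) (T : Mat N) where
  private
    Δ : Mat N → ℤ
    Δ M = det N (T · M) - det N T * det N M

    ·-cong : ∀ {M M′ : Mat N} → (∀ r c → M r c ≡ M′ r c) → ∀ r c → (T · M) r c ≡ (T · M′) r c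
    ·-cong e r c = sumFin-cong N (λ k → cong (T r k *_) (e k c))

    ·-agreeOff : ∀ {A C : Mat N} {c} → AgreeOff c A C → AgreeOff c (T · A) (T · C)
    ·-agreeOff agree r c′ c′≢c = sumFin-cong N (λ k → cong (T r k *_) (agree k c′ c′≢c))

    Δ-isAlternating : IsAlternating N Δ
    Δ-isAlternating = record
      { Δ-cong      = λ e → cong₂ (λ x y → x - det N T * y) (det-cong N (·-cong e)) (det-cong N e)
      ; additive    = additive
      ; homogeneous = homogeneous
      ; alternating = alternating
      }
      where
      additive : ∀ A B C c → (∀ r → C r c ≡ A r c + B r c) → AgreeOff c A C → AgreeOff c B C →
                 Δ C ≡ Δ A + Δ B
      additive A B C c eC eA eB =
        trans (cong₂ (λ x y → x - det N T * y)
                     (det-column-+ N (T · A) (T · B) (T · C) c column (·-agreeOff eA) (·-agreeOff eB))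
                     (det-column-+ N A B C c eC eA eB))
              (regroup (det N (T · A)) (det N (T · B)) (det N T) (det N A) (det N B))
        where
        column : ∀ r → (T · C) r c ≡ (T · A) r c + (T · B) r c
        column r = trans (sumFin-cong N (λ k → trans (cong (T r k *_) (eC k)) (ℤP.*-distribˡ-+ (T r k) (A k c) (B k c))))
                         (sumFin-+ N (λ k → T r k * A k c) (λ k → T r k * B k c))
        regroup : ∀ x y t a b → (x + y) - t * (a + b) ≡ (x - t * a) + (y - t * b)
        regroup = solve-∀

      homogeneous : ∀ A C c t → (∀ r → C r c ≡ t * A r c) → AgreeOff c A C → Δ C ≡ t * Δ A
      homogeneous A C c t eC eA =
        trans (cong₂ (λ x y → x - det N T * y)
                     (det-column-* N (T · A) (T · C) c t column (·-agreeOff eA))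
                     (det-column-* N A C c t eC eA))
              (factor (det N (T · A)) (det N T) (det N A) t)
        where
        column : ∀ r → (T · C) r c ≡ t * (T · A) r c
        column r = trans (sumFin-cong N (λ k → trans (cong (T r k *_) (eC k)) (ℤ*.x∙yz≈y∙xz (T r k) t (A k c))))
                         (sym (*-distribˡ-sumFin N t (λ k → T r k * A k c)))
        factor : ∀ x u a t → t * x - u * (t * a) ≡ t * (x - u * a)
        factor = solve-∀

      alternating : ∀ M c d → Adjacent c d → (∀ r → M r c ≡ M r d) → Δ M ≡ 0ℤ
      alternating M c d d≡1+c eM =
        trans (cong₂ (λ x y → x - det N T * y)
                     (det-adjacent N (T · M) c d d≡1+c (λ r → sumFin-cong N (λ k → cong (T r k *_) (eM k))))
                     (det-adjacent N M c d d≡1+c eM))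
              (vanish (det N T))
        where
        vanish : ∀ t → 0ℤ - t * 0ℤ ≡ 0ℤ
        vanish = solve-∀

    Δ-I : Δ I ≡ 0ℤ
    Δ-I = trans (cong₂ (λ x y → x - det N T * y) (det-cong N T·I≡T) (det-I N)) (cancel (det N T))
      where
      T·I≡T : ∀ r c → (T · I) r c ≡ T r c
      T·I≡T r c = trans (sumFin-single N _ c (λ k k≢c → trans (cong (T r k *_) (I-offDiagonal k≢c)) (ℤP.*-zeroʳ (T r k))))
                        (trans (cong (T r c *_) (I-diagonal c)) (ℤP.*-identityʳ (T r c)))
      cancel : ∀ t → t - t * 1ℤ ≡ 0ℤ
      cancel = solve-∀

  det-· : ∀ M → det N (T · M) ≡ det N T * det N M
  det-· M = begin
    det N (T · M)
      ≡⟨ rearrange (det N (T · M)) (det N T * det N M) ⟩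
    Δ M + det N T * det N M
      ≡⟨ cong (_+ det N T * det N M) (Δ-vanishes Δ-isAlternating Δ-I M) ⟩
    0ℤ + det N T * det N M
      ≡⟨ ℤP.+-identityˡ _ ⟩
    det N T * det N M ∎
    where
    open ≡-Reasoning
    rearrange : ∀ x y → x ≡ (x - y) + y
    rearrange = solve-∀

∣2^⇒≡2^ : ∀ k {d} → d ∣ 2 ℕ.^ k → ∃ λ e → d ≡ 2 ℕ.^ e
∣2^⇒≡2^ zero    d∣1 = 0 , ∣1⇒≡1 d∣1
∣2^⇒≡2^ (suc k) {d} d∣2^[1+k] with 2 ∣? d
... | yes (divides d′ refl)
  with ∣2^⇒≡2^ k (*-cancelʳ-∣ {d′} 2 (subst (d′ ℕ.* 2 ∣_) (ℕP.*-comm 2 (2 ℕ.^ k)) d∣2^[1+k]))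
...   | e , d′≡2^e = suc e , trans (cong (ℕ._* 2) d′≡2^e) (ℕP.*-comm (2 ℕ.^ e) 2)
∣2^⇒≡2^ (suc k) {d} (divides q 2^[1+k]≡qd) | no 2∤d
  with euclidsLemma q d prime[2] (divides (2 ℕ.^ k) (trans (sym 2^[1+k]≡qd) (ℕP.*-comm 2 (2 ℕ.^ k))))
... | inj₂ 2∣d = ⊥-elim (2∤d 2∣d)
... | inj₁ (divides q′ refl) = ∣2^⇒≡2^ k (divides q′ (ℕP.*-cancelˡ-≡ (2 ℕ.^ k) (q′ ℕ.* d) 2 (begin
  2 ℕ.* 2 ℕ.^ k      ≡⟨ 2^[1+k]≡qd ⟩
  q′ ℕ.* 2 ℕ.* d     ≡⟨ cong (ℕ._* d) (ℕP.*-comm q′ 2) ⟩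
  2 ℕ.* q′ ℕ.* d     ≡⟨ ℕP.*-assoc 2 q′ d ⟩
  2 ℕ.* (q′ ℕ.* d)   ∎)))
  where open ≡-Reasoning

pos-^ : ∀ a n → (+ a) ^ n ≡ + (a ℕ.^ n)
pos-^ a zero    = refl
pos-^ a (suc n) = trans (cong (+ a *_) (pos-^ a n)) (sym (ℤP.pos-* a (a ℕ.^ n)))

±-∣∣ : ∀ x → (x ≡ + ∣ x ∣) ⊎ (x ≡ - (+ ∣ x ∣))
±-∣∣ (+ n)    = inj₁ refl
±-∣∣ -[1+ n ] = inj₂ refl

det-±2^ : ∀ N (T S : Mat N) E → (∀ r c → (T · S) r c ≡ + (2 ℕ.^ E) * I r c) →
          Σ ℕ (λ e → (det N S ≡ + (2 ℕ.^ e)) ⊎ (det N S ≡ - (+ (2 ℕ.^ e))))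
det-±2^ N T S E T·S≡2^E·I with ∣2^⇒≡2^ (E ℕ.* N) (divides ∣ det N T ∣ 2^EN≡∣detT∣∣detS∣)
  where
  2^EN≡∣detT∣∣detS∣ : 2 ℕ.^ (E ℕ.* N) ≡ ∣ det N T ∣ ℕ.* ∣ det N S ∣
  2^EN≡∣detT∣∣detS∣ = begin
    2 ℕ.^ (E ℕ.* N)               ≡⟨ ℕP.^-*-assoc 2 E N ⟨
    (2 ℕ.^ E) ℕ.^ N               ≡⟨ cong ∣_∣ (pos-^ (2 ℕ.^ E) N) ⟨
    ∣ (+ (2 ℕ.^ E)) ^ N ∣         ≡⟨ cong ∣_∣ (det-scalar N (+ (2 ℕ.^ E))) ⟨
    ∣ det N (λ r c → + (2 ℕ.^ E) * I r c) ∣ ≡⟨ cong ∣_∣ (det-cong N T·S≡2^E·I) ⟨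
    ∣ det N (T · S) ∣             ≡⟨ cong ∣_∣ (det-· N T S) ⟩
    ∣ det N T * det N S ∣         ≡⟨ ℤP.abs-* (det N T) (det N S) ⟩
    ∣ det N T ∣ ℕ.* ∣ det N S ∣   ∎
    where open ≡-Reasoning
... | e , ∣detS∣≡2^e with ±-∣∣ (det N S)
...   | inj₁ positive = e , inj₁ (trans positive (cong +_ ∣detS∣≡2^e))
...   | inj₂ negative = e , inj₂ (trans negative (cong (λ k → - (+ k)) ∣detS∣≡2^e))

-- Polynomials as coefficient functions

sumℤ : ℕ → (ℕ → ℤ) → ℤ
sumℤ zero    h = 0ℤ
sumℤ (suc k) h = h 0 + sumℤ k (h ∘ suc)

sumℤ-cong : ∀ k {h h′ : ℕ → ℤ} → (∀ s → s ℕ.< k → h s ≡ h′ s) → sumℤ k h ≡ sumℤ k h′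
sumℤ-cong zero    e = refl
sumℤ-cong (suc k) e = cong₂ _+_ (e 0 (s≤s z≤n)) (sumℤ-cong k (λ s s<k → e (suc s) (s≤s s<k)))

sumℤ-+ : ∀ k (h h′ : ℕ → ℤ) → sumℤ k (λ s → h s + h′ s) ≡ sumℤ k h + sumℤ k h′
sumℤ-+ zero    h h′ = refl
sumℤ-+ (suc k) h h′ rewrite sumℤ-+ k (h ∘ suc) (h′ ∘ suc) =
  interchange (h 0) (h′ 0) (sumℤ k (h ∘ suc)) (sumℤ k (h′ ∘ suc))

*-distribˡ-sumℤ : ∀ k t (h : ℕ → ℤ) → t * sumℤ k h ≡ sumℤ k (λ s → t * h s)
*-distribˡ-sumℤ zero    t h = ℤP.*-zeroʳ t
*-distribˡ-sumℤ (suc k) t h rewrite sym (*-distribˡ-sumℤ k t (h ∘ suc)) = ℤP.*-distribˡ-+ t (h 0) _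

sumℤ-zero : ∀ k {h : ℕ → ℤ} → (∀ s → s ℕ.< k → h s ≡ 0ℤ) → sumℤ k h ≡ 0ℤ
sumℤ-zero zero    e = refl
sumℤ-zero (suc k) e rewrite e 0 (s≤s z≤n) | sumℤ-zero k (λ s s<k → e (suc s) (s≤s s<k)) = refl

sumℤ-last : ∀ k (h : ℕ → ℤ) → sumℤ (suc k) h ≡ sumℤ k h + h k
sumℤ-last zero    h = trans (ℤP.+-identityʳ (h 0)) (sym (ℤP.+-identityˡ (h 0)))
sumℤ-last (suc k) h rewrite sumℤ-last k (h ∘ suc) = sym (ℤP.+-assoc (h 0) _ (h (suc k)))

sumℤ-split : ∀ k j (h : ℕ → ℤ) → sumℤ (k ℕ.+ j) h ≡ sumℤ k h + sumℤ j (λ s → h (k ℕ.+ s))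
sumℤ-split zero    j h = sym (ℤP.+-identityˡ _)
sumℤ-split (suc k) j h rewrite sumℤ-split k j (h ∘ suc) = sym (ℤP.+-assoc (h 0) _ _)

sumℤ-extend : ∀ {k K} (h : ℕ → ℤ) → k ℕ.≤ K → (∀ s → k ℕ.≤ s → h s ≡ 0ℤ) → sumℤ K h ≡ sumℤ k h
sumℤ-extend {k} {K} h k≤K vanish = begin
  sumℤ K h
    ≡⟨ cong (λ K → sumℤ K h) (ℕP.m+[n∸m]≡n k≤K) ⟨
  sumℤ (k ℕ.+ (K ∸ k)) h
    ≡⟨ sumℤ-split k (K ∸ k) h ⟩
  sumℤ k h + sumℤ (K ∸ k) (λ s → h (k ℕ.+ s))
    ≡⟨ cong (λ x → sumℤ k h + x) (sumℤ-zero (K ∸ k) (λ s _ → vanish (k ℕ.+ s) (ℕP.m≤m+n k s))) ⟩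
  sumℤ k h + 0ℤ
    ≡⟨ ℤP.+-identityʳ _ ⟩
  sumℤ k h ∎
  where open ≡-Reasoning

sumℤ-reverse : ∀ k (h : ℕ → ℤ) → sumℤ (suc k) h ≡ sumℤ (suc k) (λ s → h (k ∸ s))
sumℤ-reverse zero    h = refl
sumℤ-reverse (suc k) h =
  trans (sumℤ-last (suc k) h) (trans (cong (_+ h (suc k)) (sumℤ-reverse k h)) (ℤP.+-comm _ (h (suc k))))

sumFin-toℕ : ∀ k (h : ℕ → ℤ) → sumFin k (h ∘ toℕ) ≡ sumℤ k h
sumFin-toℕ zero    h = refl
sumFin-toℕ (suc k) h = cong (λ x → h 0 + x) (sumFin-toℕ k (h ∘ suc))

-- The coefficient of x^D in x^s·F, where z is the zero coefficient.
shift : {A : Set} → A → ℕ → (ℕ → A) → ℕ → A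
shift z zero    F D       = F D
shift z (suc s) F zero    = z
shift z (suc s) F (suc D) = shift z s F D

module _ {A : Set} (z : A) where

  shift-+ : ∀ s F k → shift z s F (s ℕ.+ k) ≡ F k
  shift-+ zero    F k = refl
  shift-+ (suc s) F k = shift-+ s F k

  shift-< : ∀ s F {D} → D ℕ.< s → shift z s F D ≡ z
  shift-< (suc s) F {zero}  _         = refl
  shift-< (suc s) F {suc D} (s≤s D<s) = shift-< s F D<s

  shift-≥ : ∀ s F {D} → s ℕ.≤ D → shift z s F D ≡ F (D ∸ s)
  shift-≥ zero    F         _         = refl
  shift-≥ (suc s) F {suc D} (s≤s s≤D) = shift-≥ s F s≤D

  shift-cong : ∀ s {F G : ℕ → A} → (∀ k → F k ≡ G k) → ∀ D → shift z s F D ≡ shift z s G D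
  shift-cong zero    e D       = e D
  shift-cong (suc s) e zero    = refl
  shift-cong (suc s) e (suc D) = shift-cong s e D

shift-map : ∀ {A B : Set} {z : A} {z′ : B} (φ : A → B) → φ z ≡ z′ →
            ∀ s F D → φ (shift z s F D) ≡ shift z′ s (φ ∘ F) D
shift-map φ φz≡z′ zero    F D       = refl
shift-map φ φz≡z′ (suc s) F zero    = φz≡z′
shift-map φ φz≡z′ (suc s) F (suc D) = shift-map φ φz≡z′ s F D

Degree≤ : ℕ → (ℕ → ℤ) → Set
Degree≤ a F = ∀ k → a ℕ.< k → F k ≡ 0ℤ

coeffZ : ∀ {n} → MonicZ n → ℕ → ℤ
coeffZ f = coeff (+ 0) (coeffsZ f)

coeffZ-leading : ∀ {n} (f : MonicZ n) → coeffZ f n ≡ 1ℤ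
coeffZ-leading []      = refl
coeffZ-leading (_ ∷ f) = coeffZ-leading f

coeffZ-degree : ∀ {n} (f : MonicZ n) → Degree≤ n (coeffZ f)
coeffZ-degree []      (suc zero)    _         = refl
coeffZ-degree []      (suc (suc k)) _         = refl
coeffZ-degree (_ ∷ f) (suc k)       (s≤s n<k) = coeffZ-degree f k n<k

-- The coefficient of x^D in u·F, for u of degree < k.
mulCoeff : ℕ → (ℕ → ℤ) → (ℕ → ℤ) → ℕ → ℤ
mulCoeff k u F D = sumℤ k (λ s → u s * shift 0ℤ s F D)

convolution : (ℕ → ℤ) → (ℕ → ℤ) → ℕ → ℤ
convolution G F D = sumℤ (suc D) (λ s → G s * F (D ∸ s))

mulCoeff≡convolution : ∀ b F G → Degree≤ b G → ∀ D → mulCoeff (suc b) G F D ≡ convolution G F D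
mulCoeff≡convolution b F G deg-G D = begin
  sumℤ (suc b) h
    ≡⟨ sumℤ-extend h (ℕP.m≤m+n (suc b) (suc D)) beyond-G ⟨
  sumℤ (suc b ℕ.+ suc D) h
    ≡⟨ sumℤ-extend h (ℕP.m≤n+m (suc D) (suc b)) beyond-D ⟩
  sumℤ (suc D) h
    ≡⟨ sumℤ-cong (suc D) (λ s s≤D → cong (G s *_) (shift-≥ 0ℤ s F (ℕP.≤-pred s≤D))) ⟩
  convolution G F D ∎
  where
  open ≡-Reasoning
  h = λ s → G s * shift 0ℤ s F D
  beyond-G : ∀ s → suc b ℕ.≤ s → h s ≡ 0ℤ
  beyond-G s b<s = trans (cong (_* shift 0ℤ s F D) (deg-G s b<s)) (ℤP.*-zeroˡ (shift 0ℤ s F D))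
  beyond-D : ∀ s → suc D ℕ.≤ s → h s ≡ 0ℤ
  beyond-D s D<s = trans (cong (G s *_) (shift-< 0ℤ s F D<s)) (ℤP.*-zeroʳ (G s))

convolution-comm : ∀ G F D → convolution G F D ≡ convolution F G D
convolution-comm G F D = trans (sumℤ-reverse D (λ s → G s * F (D ∸ s)))
  (sumℤ-cong (suc D) (λ s s≤D → trans (cong (G (D ∸ s) *_) (cong F (ℕP.m∸[m∸n]≡n (ℕP.≤-pred s≤D))))
                                       (ℤP.*-comm (G (D ∸ s)) (F s))))

mulCoeff-comm : ∀ a b F G → Degree≤ a F → Degree≤ b G → ∀ D → mulCoeff (suc b) G F D ≡ mulCoeff (suc a) F G D
mulCoeff-comm a b F G deg-F deg-G D =
  trans (mulCoeff≡convolution b F G deg-G D)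
        (trans (convolution-comm G F D) (sym (mulCoeff≡convolution a G F deg-F D)))

n+1+m≡m+1+n : ∀ n m → n ℕ.+ suc m ≡ m ℕ.+ suc n
n+1+m≡m+1+n n m = trans (ℕP.+-suc n m) (trans (cong suc (ℕP.+-comm n m)) (sym (ℕP.+-suc m n)))

-- Only s = p reaches degree p + q + 1 in x^s·F.
mulCoeff-leading : ∀ p q (u F : ℕ → ℤ) → F (suc q) ≡ 1ℤ → Degree≤ (suc q) F →
                   mulCoeff (suc p) u F (p ℕ.+ suc q) ≡ u p
mulCoeff-leading p q u F monic deg-F = begin
  mulCoeff (suc p) u F (p ℕ.+ suc q)
    ≡⟨ sumℤ-last p _ ⟩
  mulCoeff p u F (p ℕ.+ suc q) + u p * shift 0ℤ p F (p ℕ.+ suc q)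
    ≡⟨ cong₂ _+_ (sumℤ-zero p below) (cong (u p *_) (trans (shift-+ 0ℤ p F (suc q)) monic)) ⟩
  0ℤ + u p * 1ℤ
    ≡⟨ trans (ℤP.+-identityˡ _) (ℤP.*-identityʳ (u p)) ⟩
  u p ∎
  where
  open ≡-Reasoning
  below : ∀ s → s ℕ.< p → u s * shift 0ℤ s F (p ℕ.+ suc q) ≡ 0ℤ
  below s s<p = trans (cong (u s *_) above-F) (ℤP.*-zeroʳ (u s))
    where
    j = p ∸ suc s
    p+q+1≡s+j : p ℕ.+ suc q ≡ s ℕ.+ (suc j ℕ.+ suc q)
    p+q+1≡s+j = trans (cong (ℕ._+ suc q) (sym (trans (ℕP.+-suc s j) (ℕP.m+[n∸m]≡n s<p)))) (ℕP.+-assoc s (suc j) (suc q))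
    above-F : shift 0ℤ s F (p ℕ.+ suc q) ≡ 0ℤ
    above-F = trans (cong (shift 0ℤ s F) p+q+1≡s+j)
                    (trans (shift-+ 0ℤ s F (suc j ℕ.+ suc q)) (deg-F _ (s≤s (ℕP.m≤n+m (suc q) j))))

mulCoeff-linear : ∀ k (a b F : ℕ → ℤ) t D →
                  mulCoeff k (λ s → a s + t * b s) F D ≡ mulCoeff k a F D + t * mulCoeff k b F D
mulCoeff-linear k a b F t D = begin
  sumℤ k (λ s → (a s + t * b s) * shift 0ℤ s F D)
    ≡⟨ sumℤ-cong k (λ s _ → distribute (a s) t (b s) (shift 0ℤ s F D)) ⟩
  sumℤ k (λ s → a s * shift 0ℤ s F D + t * (b s * shift 0ℤ s F D))
    ≡⟨ sumℤ-+ k _ _ ⟩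
  mulCoeff k a F D + sumℤ k (λ s → t * (b s * shift 0ℤ s F D))
    ≡⟨ cong (λ x → mulCoeff k a F D + x) (*-distribˡ-sumℤ k t _) ⟨
  mulCoeff k a F D + t * mulCoeff k b F D ∎
  where
  open ≡-Reasoning
  distribute : ∀ a t b x → (a + t * b) * x ≡ a * x + t * (b * x)
  distribute = solve-∀

timesX : (ℕ → ℤ) → ℕ → ℤ
timesX u zero    = 0ℤ
timesX u (suc s) = u s

mulCoeff-timesX-0 : ∀ k u F → mulCoeff (suc k) (timesX u) F 0 ≡ 0ℤ
mulCoeff-timesX-0 k u F =
  trans (cong₂ _+_ (ℤP.*-zeroˡ (F 0)) (sumℤ-zero k (λ s _ → ℤP.*-zeroʳ (u s)))) (ℤP.+-identityʳ 0ℤ)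

mulCoeff-timesX-suc : ∀ k u F D → mulCoeff (suc k) (timesX u) F (suc D) ≡ mulCoeff k u F D
mulCoeff-timesX-suc k u F D = trans (cong (_+ mulCoeff k u F D) (ℤP.*-zeroˡ (F (suc D)))) (ℤP.+-identityˡ _)

module Reduction {m′ n′ : ℕ} (f : MonicZ (suc n′)) (g : MonicZ (suc m′)) where

  -- The coefficient of x^D in u·f + v·g, for deg u < deg g and deg v < deg f.
  combination : (ℕ → ℤ) → (ℕ → ℤ) → ℕ → ℤ
  combination u v D = mulCoeff (suc m′) u (coeffZ f) D + mulCoeff (suc n′) v (coeffZ g) D

  -- u·f + v·g = c·x^d
  Represents : ℤ → ℕ → (ℕ → ℤ) × (ℕ → ℤ) → Set
  Represents c d (u , v) = ∀ D → combination u v D ≡ c * δ D d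

  -- g·f = f·g, with the leading terms x^m·f of g·f and x^n·g of f·g split off the sums.
  gf≡fg : ∀ D → mulCoeff (suc m′) (coeffZ g) (coeffZ f) D + shift 0ℤ (suc m′) (coeffZ f) D
              ≡ mulCoeff (suc n′) (coeffZ f) (coeffZ g) D + shift 0ℤ (suc n′) (coeffZ g) D
  gf≡fg D = begin
    mulCoeff (suc m′) gc fc D + shift 0ℤ (suc m′) fc D
      ≡⟨ cong (λ x → mulCoeff (suc m′) gc fc D + x) (leading g fc) ⟨
    mulCoeff (suc m′) gc fc D + gc (suc m′) * shift 0ℤ (suc m′) fc D
      ≡⟨ sumℤ-last (suc m′) (λ s → gc s * shift 0ℤ s fc D) ⟨
    mulCoeff (suc (suc m′)) gc fc D
      ≡⟨ mulCoeff-comm (suc n′) (suc m′) fc gc (coeffZ-degree f) (coeffZ-degree g) D ⟩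
    mulCoeff (suc (suc n′)) fc gc D
      ≡⟨ sumℤ-last (suc n′) (λ s → fc s * shift 0ℤ s gc D) ⟩
    mulCoeff (suc n′) fc gc D + fc (suc n′) * shift 0ℤ (suc n′) gc D
      ≡⟨ cong (λ x → mulCoeff (suc n′) fc gc D + x) (leading f gc) ⟩
    mulCoeff (suc n′) fc gc D + shift 0ℤ (suc n′) gc D ∎
    where
    open ≡-Reasoning
    fc = coeffZ f
    gc = coeffZ g
    leading : ∀ {k} (h : MonicZ k) F → coeffZ h k * shift 0ℤ k F D ≡ shift 0ℤ k F D
    leading {k} h F = trans (cong (_* shift 0ℤ k F D) (coeffZ-leading h)) (ℤP.*-identityˡ (shift 0ℤ k F D))

  combination-top : ∀ u v → combination u v (m′ ℕ.+ suc n′) ≡ u m′ + v n′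
  combination-top u v = cong₂ _+_
    (mulCoeff-leading m′ n′ u (coeffZ f) (coeffZ-leading f) (coeffZ-degree f))
    (trans (cong (mulCoeff (suc n′) v (coeffZ g)) (n+1+m≡m+1+n m′ n′))
           (mulCoeff-leading n′ m′ v (coeffZ g) (coeffZ-leading g) (coeffZ-degree g)))

  -- With t the top coefficient of u, the degree-m coefficient of x·u − t·g cancels.
  next : (ℕ → ℤ) × (ℕ → ℤ) → (ℕ → ℤ) × (ℕ → ℤ)
  next (u , v) = (λ s → timesX u s + (- u m′) * coeffZ g s) , (λ s → timesX v s + u m′ * coeffZ f s)

  private
    module Next (u v : ℕ → ℤ) where
      t = u m′
      fc = coeffZ f
      gc = coeffZ g
      gf fg : ℕ → ℤ
      gf = mulCoeff (suc m′) gc fc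
      fg = mulCoeff (suc n′) fc gc

      xu xv next-combination : ℕ → ℤ
      xu = mulCoeff (suc m′) (timesX u) fc
      xv = mulCoeff (suc n′) (timesX v) gc
      next-combination = combination (proj₁ (next (u , v))) (proj₂ (next (u , v)))

      expand : ∀ D → next-combination D ≡ (xu D + (- t) * gf D) + (xv D + t * fg D)
      expand D = cong₂ _+_ (mulCoeff-linear (suc m′) (timesX u) gc fc (- t) D)
                           (mulCoeff-linear (suc n′) (timesX v) fc gc t D)

      at-0 : next-combination 0 ≡ 0ℤ
      at-0 = begin
        next-combination 0
          ≡⟨ expand 0 ⟩
        (xu 0 + (- t) * gf 0) + (xv 0 + t * fg 0)
          ≡⟨ cong₂ (λ a b → (a + (- t) * gf 0) + (b + t * fg 0))
                   (mulCoeff-timesX-0 m′ u fc) (mulCoeff-timesX-0 n′ v gc) ⟩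
        (0ℤ + (- t) * gf 0) + (0ℤ + t * fg 0)
          ≡⟨ cong (λ x → (0ℤ + (- t) * gf 0) + (0ℤ + t * x)) gf0≡fg0 ⟨
        (0ℤ + (- t) * gf 0) + (0ℤ + t * gf 0)
          ≡⟨ cancel t (gf 0) ⟩
        0ℤ ∎
        where
        open ≡-Reasoning
        gf0≡fg0 : gf 0 ≡ fg 0
        gf0≡fg0 = trans (sym (ℤP.+-identityʳ (gf 0))) (trans (gf≡fg 0) (ℤP.+-identityʳ (fg 0)))
        cancel : ∀ t x → (0ℤ + (- t) * x) + (0ℤ + t * x) ≡ 0ℤ
        cancel = solve-∀

      at-suc : v n′ ≡ - t → ∀ D → next-combination (suc D) ≡ combination u v D
      at-suc v-top D = begin
        next-combination (suc D)
          ≡⟨ expand (suc D) ⟩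
        (xu (suc D) + (- t) * gf (suc D)) + (xv (suc D) + t * fg (suc D))
          ≡⟨ cong₂ (λ a b → (a + (- t) * gf (suc D)) + (b + t * fg (suc D)))
                   (mulCoeff-timesX-suc m′ u fc D) (mulCoeff-timesX-suc n′ v gc D) ⟩
        (Lu + (- t) * gf (suc D)) + (Lv + t * fg (suc D))
          ≡⟨ rearrange Lu Lv t (shift 0ℤ m′ fc D) (shift 0ℤ n′ gc D) (gf (suc D)) (fg (suc D)) (gf≡fg (suc D)) ⟩
        (Lu + t * shift 0ℤ m′ fc D) + (Lv + (- t) * shift 0ℤ n′ gc D)
          ≡⟨ cong (λ b → (Lu + t * shift 0ℤ m′ fc D) + (Lv + b * shift 0ℤ n′ gc D)) v-top ⟨
        (Lu + t * shift 0ℤ m′ fc D) + (Lv + v n′ * shift 0ℤ n′ gc D)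
          ≡⟨ cong₂ _+_ (sumℤ-last m′ (λ s → u s * shift 0ℤ s fc D))
                       (sumℤ-last n′ (λ s → v s * shift 0ℤ s gc D)) ⟨
        combination u v D ∎
        where
        open ≡-Reasoning
        Lu = mulCoeff m′ u fc D
        Lv = mulCoeff n′ v gc D
        rearrange : ∀ Lu Lv t x y G F → G + x ≡ F + y →
                    (Lu + (- t) * G) + (Lv + t * F) ≡ (Lu + t * x) + (Lv + (- t) * y)
        rearrange Lu Lv t x y G F G+x≡F+y =
          trans (cong (λ z → (Lu + (- t) * G) + (Lv + t * z)) F≡G+x-y) (normalise Lu Lv t x y G)
          where
          add-sub : ∀ F y → F ≡ (F + y) - y
          add-sub = solve-∀
          F≡G+x-y : F ≡ (G + x) - y
          F≡G+x-y = trans (add-sub F y) (cong (_- y) (sym G+x≡F+y))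
          normalise : ∀ Lu Lv t x y G →
                      (Lu + (- t) * G) + (Lv + t * ((G + x) - y)) ≡ (Lu + t * x) + (Lv + (- t) * y)
          normalise = solve-∀

  represents-next : ∀ {c d} uv → suc d ℕ.≤ m′ ℕ.+ suc n′ → Represents c d uv → Represents c (suc d) (next uv)
  represents-next {c} {d} (u , v) d<M represents = λ where
      zero    → trans (Next.at-0 u v) (sym (ℤP.*-zeroʳ c))
      (suc D) → trans (Next.at-suc u v v-top D) (represents D)
    where
    top-vanishes : u m′ + v n′ ≡ 0ℤ
    top-vanishes = trans (sym (combination-top u v)) (trans (represents (m′ ℕ.+ suc n′))
                     (trans (cong (c *_) (δ-≢ (λ M≡d → ℕP.<-irrefl (sym M≡d) d<M))) (ℤP.*-zeroʳ c)))
    v-top : v n′ ≡ - u m′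
    v-top = ℤ-group.inverseʳ-unique (u m′) (v n′) top-vanishes

-- The Sylvester matrix

-- Column j of a Sylvester row that lists the K + 1 coefficients of F, highest first, from column i on.
band : ℕ → (ℕ → ℤ) → ℕ → ℕ → ℤ
band K F i j = if (i ≤ᵇ j) ∧ ((j ∸ i) ≤ᵇ K) then F (K ∸ (j ∸ i)) else + 0

-- sylvester f g r c unfolds to sylvesterEntry f g (toℕ r) (toℕ c).
sylvesterEntry : ∀ {n m} → MonicZ n → MonicZ m → ℕ → ℕ → ℤ
sylvesterEntry {n} {m} f g i j = if i <ᵇ m then band n (coeffZ f) i j else band m (coeffZ g) (i ∸ m) j

column-degree : ∀ {i a K j} → i ℕ.≤ j → i ℕ.+ a ℕ.+ K ∸ j ≡ (a ℕ.+ K) ∸ (j ∸ i)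
column-degree {i} {a} {K} {j} i≤j =
  trans (cong₂ _∸_ (ℕP.+-assoc i a K) (sym (ℕP.m+[n∸m]≡n i≤j))) (ℕP.[m+n]∸[m+o]≡n∸o i (a ℕ.+ K) (j ∸ i))

-- Reading the columns right to left as degrees, the band starting at column i is x^a·F.
band-shift : ∀ i a K j (F : ℕ → ℤ) → Degree≤ K F → j ℕ.< i ℕ.+ suc a ℕ.+ K →
             band K F i j ≡ shift 0ℤ a F (i ℕ.+ a ℕ.+ K ∸ j)
band-shift i a K j F deg-F j<end with i ≤ᵇ j | ℕP.≤ᵇ-reflects-≤ i j
... | false | ofⁿ i≰j =
  sym (trans (cong (shift 0ℤ a F) degree) (trans (shift-+ 0ℤ a F (suc e ℕ.+ K)) (deg-F _ (s≤s (ℕP.m≤n+m K e)))))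
  where
  e = i ∸ suc j
  i≡j+1+e : i ≡ j ℕ.+ suc e
  i≡j+1+e = sym (trans (ℕP.+-suc j e) (ℕP.m+[n∸m]≡n (ℕP.≰⇒> i≰j)))
  degree : i ℕ.+ a ℕ.+ K ∸ j ≡ a ℕ.+ (suc e ℕ.+ K)
  degree = trans (cong (λ i → i ℕ.+ a ℕ.+ K ∸ j) i≡j+1+e)
                 (trans (cong (_∸ j) (regroup j e a K)) (ℕP.m+n∸m≡n j (a ℕ.+ (suc e ℕ.+ K))))
    where regroup : ∀ j e a K → j ℕ.+ suc e ℕ.+ a ℕ.+ K ≡ j ℕ.+ (a ℕ.+ (suc e ℕ.+ K))
          regroup = ℕSolver.solve-∀
... | true | ofʸ i≤j with (j ∸ i) ≤ᵇ K | ℕP.≤ᵇ-reflects-≤ (j ∸ i) K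
...   | true  | ofʸ b≤K =
  sym (trans (cong (shift 0ℤ a F) (trans (column-degree i≤j) (ℕP.+-∸-assoc a b≤K))) (shift-+ 0ℤ a F (K ∸ (j ∸ i))))
...   | false | ofⁿ b≰K = sym (shift-< 0ℤ a F (subst (ℕ._< a) (sym (column-degree i≤j)) below-a))
  where
  b≤a+K : j ∸ i ℕ.≤ a ℕ.+ K
  b≤a+K = ℕP.≤-pred (ℕP.+-cancelˡ-< i (j ∸ i) (suc (a ℕ.+ K))
            (subst₂ ℕ._<_ (sym (ℕP.m+[n∸m]≡n i≤j)) (ℕP.+-assoc i (suc a) K) j<end))
  below-a : (a ℕ.+ K) ∸ (j ∸ i) ℕ.< a
  below-a = ℕP.+-cancelʳ-< (j ∸ i) ((a ℕ.+ K) ∸ (j ∸ i)) a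
              (subst (ℕ._< a ℕ.+ (j ∸ i)) (sym (ℕP.m∸n+n≡m b≤a+K)) (ℕP.+-monoʳ-< a (ℕP.≰⇒> b≰K)))

highestFirst : ∀ k → (ℕ → ℤ) → Fin (suc k) → ℤ
highestFirst k u i = u (k ∸ toℕ i)

sumFin-highestFirst : ∀ k (u F : ℕ → ℤ) D →
                      sumFin (suc k) (λ i → highestFirst k u i * shift 0ℤ (k ∸ toℕ i) F D) ≡ mulCoeff (suc k) u F D
sumFin-highestFirst k u F D = trans (sumFin-toℕ (suc k) (λ s → u (k ∸ s) * shift 0ℤ (k ∸ s) F D))
                                    (sym (sumℤ-reverse k (λ s → u s * shift 0ℤ s F D)))

module SylvesterRows {m′ n′ : ℕ} (f : MonicZ (suc n′)) (g : MonicZ (suc m′)) where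
  open Reduction f g

  N = suc m′ ℕ.+ suc n′
  M = m′ ℕ.+ suc n′

  entry-f : ∀ i j → i ℕ.< suc m′ → j ℕ.< N →
            sylvesterEntry f g i j ≡ shift 0ℤ (m′ ∸ i) (coeffZ f) (M ∸ j)
  entry-f i j i<m j<N with i <ᵇ suc m′ | ℕP.<ᵇ-reflects-< i (suc m′)
  ... | false | ofⁿ i≮m = ⊥-elim (i≮m i<m)
  ... | true  | ofʸ _   =
    trans (band-shift i (m′ ∸ i) (suc n′) j (coeffZ f) (coeffZ-degree f)
             (subst (λ k → j ℕ.< k ℕ.+ suc n′) (sym i+1+a≡m) j<N))
          (cong (λ k → shift 0ℤ (m′ ∸ i) (coeffZ f) (k ℕ.+ suc n′ ∸ j)) i+a≡m)
    where
    i+a≡m : i ℕ.+ (m′ ∸ i) ≡ m′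
    i+a≡m = ℕP.m+[n∸m]≡n (ℕP.≤-pred i<m)
    i+1+a≡m : i ℕ.+ suc (m′ ∸ i) ≡ suc m′
    i+1+a≡m = trans (ℕP.+-suc i (m′ ∸ i)) (cong suc i+a≡m)

  entry-g : ∀ i j → i ℕ.< suc n′ → j ℕ.< N →
            sylvesterEntry f g (suc m′ ℕ.+ i) j ≡ shift 0ℤ (n′ ∸ i) (coeffZ g) (M ∸ j)
  entry-g i j i<n j<N with suc m′ ℕ.+ i <ᵇ suc m′ | ℕP.<ᵇ-reflects-< (suc m′ ℕ.+ i) (suc m′)
  ... | true  | ofʸ m+i<m = ⊥-elim (ℕP.m+n≮m (suc m′) i m+i<m)
  ... | false | ofⁿ _     rewrite ℕP.m+n∸m≡n (suc m′) i =
    trans (band-shift i (n′ ∸ i) (suc m′) j (coeffZ g) (coeffZ-degree g)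
             (subst (λ k → j ℕ.< k ℕ.+ suc m′) (sym i+1+a≡n) (subst (j ℕ.<_) (ℕP.+-comm (suc m′) (suc n′)) j<N)))
          (cong (λ k → shift 0ℤ (n′ ∸ i) (coeffZ g) (k ∸ j)) i+a+m≡M)
    where
    i+a≡n : i ℕ.+ (n′ ∸ i) ≡ n′
    i+a≡n = ℕP.m+[n∸m]≡n (ℕP.≤-pred i<n)
    i+1+a≡n : i ℕ.+ suc (n′ ∸ i) ≡ suc n′
    i+1+a≡n = trans (ℕP.+-suc i (n′ ∸ i)) (cong suc i+a≡n)
    i+a+m≡M : i ℕ.+ (n′ ∸ i) ℕ.+ suc m′ ≡ M
    i+a+m≡M = trans (cong (ℕ._+ suc m′) i+a≡n) (n+1+m≡m+1+n n′ m′)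

  sylvester-↑ˡ : ∀ (i : Fin (suc m′)) col →
                 sylvester f g (i ↑ˡ suc n′) col ≡ shift 0ℤ (m′ ∸ toℕ i) (coeffZ f) (M ∸ toℕ col)
  sylvester-↑ˡ i col = trans (cong (λ k → sylvesterEntry f g k (toℕ col)) (toℕ-↑ˡ i (suc n′)))
                             (entry-f (toℕ i) (toℕ col) (toℕ<n i) (toℕ<n col))

  sylvester-↑ʳ : ∀ (i : Fin (suc n′)) col →
                 sylvester f g (suc m′ ↑ʳ i) col ≡ shift 0ℤ (n′ ∸ toℕ i) (coeffZ g) (M ∸ toℕ col)
  sylvester-↑ʳ i col = trans (cong (λ k → sylvesterEntry f g k (toℕ col)) (toℕ-↑ʳ (suc m′) i))
                             (entry-g (toℕ i) (toℕ col) (toℕ<n i) (toℕ<n col))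

  -- Matches the rows x^(m-1)·f, …, f, x^(n-1)·g, …, g.
  rowVector : (ℕ → ℤ) × (ℕ → ℤ) → Fin N → ℤ
  rowVector (u , v) = highestFirst m′ u ++ highestFirst n′ v

  rowVector-sylvester : ∀ u v col →
                        sumFin N (λ r → rowVector (u , v) r * sylvester f g r col) ≡ combination u v (M ∸ toℕ col)
  rowVector-sylvester u v col = begin
    sumFin N (λ r → rowVector (u , v) r * sylvester f g r col)
      ≡⟨ sumFin-↑ (suc m′) (suc n′) (λ r → rowVector (u , v) r * sylvester f g r col) ⟩
    sumFin (suc m′) (λ i → rowVector (u , v) (i ↑ˡ suc n′) * sylvester f g (i ↑ˡ suc n′) col) +
    sumFin (suc n′) (λ i → rowVector (u , v) (suc m′ ↑ʳ i) * sylvester f g (suc m′ ↑ʳ i) col)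
      ≡⟨ cong₂ _+_ (sumFin-cong (suc m′) (λ i → cong₂ _*_ (lookup-++ˡ ū v̄ i) (sylvester-↑ˡ i col)))
                   (sumFin-cong (suc n′) (λ i → cong₂ _*_ (lookup-++ʳ ū v̄ i) (sylvester-↑ʳ i col))) ⟩
    sumFin (suc m′) (λ i → ū i * shift 0ℤ (m′ ∸ toℕ i) (coeffZ f) D) +
    sumFin (suc n′) (λ i → v̄ i * shift 0ℤ (n′ ∸ toℕ i) (coeffZ g) D)
      ≡⟨ cong₂ _+_ (sumFin-highestFirst m′ u (coeffZ f) D) (sumFin-highestFirst n′ v (coeffZ g) D) ⟩
    combination u v D ∎
    where
    open ≡-Reasoning
    ū = highestFirst m′ u
    v̄ = highestFirst n′ v
    D = M ∸ toℕ col

  δ-reversed : ∀ (t col : Fin N) → δ (M ∸ toℕ col) (M ∸ toℕ t) ≡ I t col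
  δ-reversed t col with t ≟ col
  ... | yes refl = trans (δ-refl (M ∸ toℕ t)) (sym (I-diagonal t))
  ... | no t≢col = trans (δ-≢ (t≢col ∘ toℕ-injective ∘ sym ∘ ℕP.∸-cancelˡ-≡ (ℕP.≤-pred (toℕ<n col)) (ℕP.≤-pred (toℕ<n t))))
                         (sym (I-offDiagonal t≢col))

  module _ {c : ℤ} (start : (ℕ → ℤ) × (ℕ → ℤ)) (represents-c : Represents c 0 start) where

    solution : ℕ → (ℕ → ℤ) × (ℕ → ℤ)
    solution = fold start next

    solution-represents : ∀ d → d ℕ.≤ M → Represents c d (solution d)
    solution-represents zero    _   = represents-c
    solution-represents (suc d) d<M = represents-next {c} (solution d) d<M (solution-represents d (ℕP.<⇒≤ d<M))

    -- Row t holds the solution of u·f + v·g = c·x^(M − t), so T · S = c·I.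
    T : Mat N
    T t = rowVector (solution (M ∸ toℕ t))

    T·sylvester : ∀ t col → (T · sylvester f g) t col ≡ c * I t col
    T·sylvester t col =
      trans (rowVector-sylvester (proj₁ (solution d)) (proj₂ (solution d)) col)
            (trans (solution-represents d (ℕP.m∸n≤m M (toℕ t)) (M ∸ toℕ col)) (cong (c *_) (δ-reversed t col)))
      where d = M ∸ toℕ t

band-1 : ∀ i j → band 0 (coeffZ {0} []) i j ≡ δ i j
band-1 i j with i ≤ᵇ j | ℕP.≤ᵇ-reflects-≤ i j
... | false | ofⁿ i≰j = sym (δ-≢ {i} {j} (λ i≡j → i≰j (ℕP.≤-reflexive i≡j)))
... | true  | ofʸ i≤j with j ∸ i ≤ᵇ 0 | ℕP.≤ᵇ-reflects-≤ (j ∸ i) 0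
...   | true  | ofʸ j∸i≤0 =
  trans (cong (λ k → coeffZ {0} [] (0 ∸ k)) j∸i≡0) (sym (trans (cong (δ i) (sym i≡j)) (δ-refl i)))
  where j∸i≡0 = ℕP.n≤0⇒n≡0 j∸i≤0
        i≡j = ℕP.≤-antisym i≤j (ℕP.m∸n≡0⇒m≤n j∸i≡0)
...   | false | ofⁿ j∸i≰0 =
  sym (δ-≢ {i} {j} (λ i≡j → j∸i≰0 (ℕP.≤-reflexive (trans (cong (j ∸_) i≡j) (ℕP.n∸n≡0 j)))))

sylvester-constantʳ : ∀ {n} (f : MonicZ n) r c → sylvester f [] r c ≡ I r c
sylvester-constantʳ f r c = band-1 (toℕ r) (toℕ c)

sylvester-constantˡ : ∀ {m} (g : MonicZ m) r c → sylvester [] g r c ≡ I r c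
sylvester-constantˡ {m} g r c with toℕ r <ᵇ m | ℕP.<ᵇ-reflects-< (toℕ r) m
... | true  | ofʸ _   = band-1 (toℕ r) (toℕ c)
... | false | ofⁿ r≮m = ⊥-elim (r≮m (subst (toℕ r ℕ.<_) (ℕP.+-identityʳ m) (toℕ<n r)))

-- Clearing denominators

ι : ℤ → ℚ
ι z = z ℚ./ 1

private
  -- z / 1 is by definition fromℚᵘ (mkℚᵘ z 0).
  toℚᵘ-ι : ∀ z → toℚᵘ (ι z) ℚᵘ.≃ ℚᵘ.mkℚᵘ z 0
  toℚᵘ-ι z = ℚP.toℚᵘ-fromℚᵘ (ℚᵘ.mkℚᵘ z 0)

  ≡-via-ℚᵘ : ∀ {p q x} → toℚᵘ p ℚᵘ.≃ x → toℚᵘ q ℚᵘ.≃ x → p ≡ q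
  ≡-via-ℚᵘ p≃x q≃x = ℚP.toℚᵘ-injective (ℚᵘP.≃-trans p≃x (ℚᵘP.≃-sym q≃x))

ι-+ : ∀ x y → ι (x ℤ.+ y) ≡ ι x ℚ.+ ι y
ι-+ x y = ≡-via-ℚᵘ (ℚᵘP.≃-trans (toℚᵘ-ι (x ℤ.+ y)) (ℚᵘ.*≡* (over-1 x y)))
                   (ℚᵘP.≃-trans (ℚP.toℚᵘ-homo-+ (ι x) (ι y)) (ℚᵘP.+-cong (toℚᵘ-ι x) (toℚᵘ-ι y)))
  where over-1 : ∀ x y → (x ℤ.+ y) ℤ.* + 1 ≡ (x ℤ.* + 1 ℤ.+ y ℤ.* + 1) ℤ.* + 1
        over-1 = solve-∀

ι-* : ∀ x y → ι (x ℤ.* y) ≡ ι x ℚ.* ι y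
ι-* x y = ≡-via-ℚᵘ (toℚᵘ-ι (x ℤ.* y))
                   (ℚᵘP.≃-trans (ℚP.toℚᵘ-homo-* (ι x) (ι y)) (ℚᵘP.*-cong (toℚᵘ-ι x) (toℚᵘ-ι y)))

ι-injective : ∀ {x y} → ι x ≡ ι y → x ≡ y
ι-injective {x} {y} ιx≡ιy with ℚᵘP.≃-trans (ℚᵘP.≃-sym (toℚᵘ-ι x)) (ℚᵘP.≃-trans (ℚP.toℚᵘ-cong ιx≡ιy) (toℚᵘ-ι y))
... | ℚᵘ.*≡* x*1≡y*1 = trans (sym (ℤP.*-identityʳ x)) (trans x*1≡y*1 (ℤP.*-identityʳ y))

/-*-cancel : ∀ c d .{{_ : ℕ.NonZero d}} → (c ℚ./ d) ℚ.* ι (+ d) ≡ ι c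
/-*-cancel c (suc d) = ≡-via-ℚᵘ
  (ℚᵘP.≃-trans (ℚP.toℚᵘ-homo-* (c ℚ./ suc d) (ι (+ suc d)))
    (ℚᵘP.≃-trans (ℚᵘP.*-cong (ℚP.toℚᵘ-fromℚᵘ (ℚᵘ.mkℚᵘ c d)) (toℚᵘ-ι (+ suc d)))
                 (ℚᵘ.*≡* (trans (ℤP.*-identityʳ _) (cong (λ k → c ℤ.* + suc k) (sym (ℕP.*-identityʳ d)))))))
  (toℚᵘ-ι c)

sumℚ : ℕ → (ℕ → ℚ) → ℚ
sumℚ zero    h = 0ℚ
sumℚ (suc k) h = h 0 ℚ.+ sumℚ k (h ∘ suc)

sumℚ-cong : ∀ k {h h′ : ℕ → ℚ} → (∀ s → s ℕ.< k → h s ≡ h′ s) → sumℚ k h ≡ sumℚ k h′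
sumℚ-cong zero    e = refl
sumℚ-cong (suc k) e = cong₂ ℚ._+_ (e 0 (s≤s z≤n)) (sumℚ-cong k (λ s s<k → e (suc s) (s≤s s<k)))

sumℚ-zero : ∀ k {h : ℕ → ℚ} → (∀ s → h s ≡ 0ℚ) → sumℚ k h ≡ 0ℚ
sumℚ-zero zero    e = refl
sumℚ-zero (suc k) e rewrite e 0 | sumℚ-zero k (e ∘ suc) = refl

*-distribˡ-sumℚ : ∀ k x (h : ℕ → ℚ) → x ℚ.* sumℚ k h ≡ sumℚ k (λ s → x ℚ.* h s)
*-distribˡ-sumℚ zero    x h = ℚP.*-zeroʳ x
*-distribˡ-sumℚ (suc k) x h = trans (ℚP.*-distribˡ-+ x (h 0) _) (cong (x ℚ.* h 0 ℚ.+_) (*-distribˡ-sumℚ k x (h ∘ suc)))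

ι-sumℤ : ∀ k (h : ℕ → ℤ) → ι (sumℤ k h) ≡ sumℚ k (ι ∘ h)
ι-sumℤ zero    h = refl
ι-sumℤ (suc k) h = trans (ι-+ (h 0) _) (cong (ι (h 0) ℚ.+_) (ι-sumℤ k (h ∘ suc)))

coeff-toQ : ∀ {n} (f : MonicZ n) k → coeff 0ℚ (toQ f) k ≡ ι (coeffZ f k)
coeff-toQ f = go (coeffsZ f)
  where go : ∀ (l : List ℤ) k → coeff 0ℚ (map ι l) k ≡ ι (coeff (+ 0) l k)
        go []      k       = refl
        go (x ∷ l) zero    = refl
        go (x ∷ l) (suc k) = go l k

coeff-addQ : ∀ p q k → coeff 0ℚ (addQ p q) k ≡ coeff 0ℚ p k ℚ.+ coeff 0ℚ q k
coeff-addQ []      q       k       = sym (ℚP.+-identityˡ _)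
coeff-addQ (x ∷ p) []      zero    = sym (ℚP.+-identityʳ x)
coeff-addQ (x ∷ p) []      (suc k) = sym (ℚP.+-identityʳ _)
coeff-addQ (x ∷ p) (y ∷ q) zero    = refl
coeff-addQ (x ∷ p) (y ∷ q) (suc k) = coeff-addQ p q k

coeff-scaleQ : ∀ x p k → coeff 0ℚ (scaleQ x p) k ≡ x ℚ.* coeff 0ℚ p k
coeff-scaleQ x []      k       = sym (ℚP.*-zeroʳ x)
coeff-scaleQ x (y ∷ p) zero    = refl
coeff-scaleQ x (y ∷ p) (suc k) = coeff-scaleQ x p k

coeff-mulQ : ∀ p q k → coeff 0ℚ (mulQ p q) k ≡ sumℚ (length p) (λ s → coeff 0ℚ p s ℚ.* shift 0ℚ s (coeff 0ℚ q) k)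
coeff-mulQ []      q k = refl
coeff-mulQ (x ∷ p) q k = trans (coeff-addQ (scaleQ x q) (0ℚ ∷ mulQ p q) k) (cong₂ ℚ._+_ (coeff-scaleQ x q k) (shifted k))
  where
  shifted : ∀ k → coeff 0ℚ (0ℚ ∷ mulQ p q) k ≡
                  sumℚ (length p) (λ s → coeff 0ℚ p s ℚ.* shift 0ℚ (suc s) (coeff 0ℚ q) k)
  shifted zero    = sym (sumℚ-zero (length p) (λ s → ℚP.*-zeroʳ (coeff 0ℚ p s)))
  shifted (suc k) = coeff-mulQ p q k

coeff-mulQ-toQ : ∀ {k n} (a : Vec ℚ k) (f : MonicZ n) D →
                 coeff 0ℚ (mulQ (vecQ a) (toQ f)) D ≡
                 sumℚ k (λ s → coeff 0ℚ (vecQ a) s ℚ.* shift 0ℚ s (ι ∘ coeffZ f) D)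
coeff-mulQ-toQ {k} a f D = begin
  coeff 0ℚ (mulQ (vecQ a) (toQ f)) D
    ≡⟨ coeff-mulQ (vecQ a) (toQ f) D ⟩
  sumℚ (length (vecQ a)) (λ s → coeff 0ℚ (vecQ a) s ℚ.* shift 0ℚ s (coeff 0ℚ (toQ f)) D)
    ≡⟨ cong (λ l → sumℚ l (λ s → coeff 0ℚ (vecQ a) s ℚ.* shift 0ℚ s (coeff 0ℚ (toQ f)) D)) (VecP.length-toList a) ⟩
  sumℚ k (λ s → coeff 0ℚ (vecQ a) s ℚ.* shift 0ℚ s (coeff 0ℚ (toQ f)) D)
    ≡⟨ sumℚ-cong k (λ s _ → cong (coeff 0ℚ (vecQ a) s ℚ.*_) (shift-cong 0ℚ s (coeff-toQ f) D)) ⟩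
  sumℚ k (λ s → coeff 0ℚ (vecQ a) s ℚ.* shift 0ℚ s (ι ∘ coeffZ f) D) ∎
  where open ≡-Reasoning

ι-mulCoeff : ∀ {k} (p : List ℚ) c (A F : ℕ → ℤ) → (∀ s → s ℕ.< k → ι (A s) ≡ coeff 0ℚ p s ℚ.* ι c) →
             ∀ D → ι (mulCoeff k A F D) ≡ ι c ℚ.* sumℚ k (λ s → coeff 0ℚ p s ℚ.* shift 0ℚ s (ι ∘ F) D)
ι-mulCoeff {k} p c A F ιA D = begin
  ι (mulCoeff k A F D)                                             ≡⟨ ι-sumℤ k _ ⟩
  sumℚ k (λ s → ι (A s ℤ.* shift 0ℤ s F D))                        ≡⟨ sumℚ-cong k term ⟩
  sumℚ k (λ s → ι c ℚ.* (coeff 0ℚ p s ℚ.* shift 0ℚ s (ι ∘ F) D))   ≡⟨ *-distribˡ-sumℚ k (ι c) _ ⟨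
  ι c ℚ.* sumℚ k (λ s → coeff 0ℚ p s ℚ.* shift 0ℚ s (ι ∘ F) D)     ∎
  where
  open ≡-Reasoning
  term : ∀ s → s ℕ.< k → ι (A s ℤ.* shift 0ℤ s F D) ≡ ι c ℚ.* (coeff 0ℚ p s ℚ.* shift 0ℚ s (ι ∘ F) D)
  term s s<k = begin
    ι (A s ℤ.* shift 0ℤ s F D)
      ≡⟨ ι-* (A s) _ ⟩
    ι (A s) ℚ.* ι (shift 0ℤ s F D)
      ≡⟨ cong₂ ℚ._*_ (ιA s s<k) (shift-map ι refl s F D) ⟩
    coeff 0ℚ p s ℚ.* ι c ℚ.* shift 0ℚ s (ι ∘ F) D
      ≡⟨ cong (ℚ._* shift 0ℚ s (ι ∘ F) D) (ℚP.*-comm (coeff 0ℚ p s) (ι c)) ⟩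
    ι c ℚ.* coeff 0ℚ p s ℚ.* shift 0ℚ s (ι ∘ F) D
      ≡⟨ ℚP.*-assoc (ι c) (coeff 0ℚ p s) _ ⟩
    ι c ℚ.* (coeff 0ℚ p s ℚ.* shift 0ℚ s (ι ∘ F) D) ∎

integral-bezout : ∀ {n m} (f : MonicZ n) (g : MonicZ m) (a : Vec ℚ m) (b : Vec ℚ n) →
                  addQ (mulQ (vecQ a) (toQ f)) (mulQ (vecQ b) (toQ g)) ≈P [ 1ℚ ] →
                  ∀ c (A B : ℕ → ℤ) →
                  (∀ s → s ℕ.< m → ι (A s) ≡ coeff 0ℚ (vecQ a) s ℚ.* ι c) →
                  (∀ s → s ℕ.< n → ι (B s) ≡ coeff 0ℚ (vecQ b) s ℚ.* ι c) →
                  ∀ D → mulCoeff m A (coeffZ f) D ℤ.+ mulCoeff n B (coeffZ g) D ≡ c ℤ.* δ D 0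
integral-bezout {n} {m} f g a b bezout c A B ιA ιB D = ι-injective (begin
  ι (mulCoeff m A (coeffZ f) D ℤ.+ mulCoeff n B (coeffZ g) D)
    ≡⟨ ι-+ (mulCoeff m A (coeffZ f) D) _ ⟩
  ι (mulCoeff m A (coeffZ f) D) ℚ.+ ι (mulCoeff n B (coeffZ g) D)
    ≡⟨ cong₂ ℚ._+_ (ι-mulCoeff (vecQ a) c A (coeffZ f) ιA D) (ι-mulCoeff (vecQ b) c B (coeffZ g) ιB D) ⟩
  ι c ℚ.* sumℚ m (λ s → coeff 0ℚ (vecQ a) s ℚ.* shift 0ℚ s (ι ∘ coeffZ f) D) ℚ.+
  ι c ℚ.* sumℚ n (λ s → coeff 0ℚ (vecQ b) s ℚ.* shift 0ℚ s (ι ∘ coeffZ g) D)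
    ≡⟨ ℚP.*-distribˡ-+ (ι c) _ _ ⟨
  ι c ℚ.* (sumℚ m (λ s → coeff 0ℚ (vecQ a) s ℚ.* shift 0ℚ s (ι ∘ coeffZ f) D) ℚ.+
           sumℚ n (λ s → coeff 0ℚ (vecQ b) s ℚ.* shift 0ℚ s (ι ∘ coeffZ g) D))
    ≡⟨ cong (ι c ℚ.*_) (cong₂ ℚ._+_ (coeff-mulQ-toQ a f D) (coeff-mulQ-toQ b g D)) ⟨
  ι c ℚ.* (coeff 0ℚ (mulQ (vecQ a) (toQ f)) D ℚ.+ coeff 0ℚ (mulQ (vecQ b) (toQ g)) D)
    ≡⟨ cong (ι c ℚ.*_) (coeff-addQ (mulQ (vecQ a) (toQ f)) (mulQ (vecQ b) (toQ g)) D) ⟨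
  ι c ℚ.* coeff 0ℚ (addQ (mulQ (vecQ a) (toQ f)) (mulQ (vecQ b) (toQ g))) D
    ≡⟨ cong (ι c ℚ.*_) (trans (bezout D) (one D)) ⟩
  ι c ℚ.* ι (δ D 0)
    ≡⟨ ι-* c (δ D 0) ⟨
  ι (c ℤ.* δ D 0) ∎)
  where
  open ≡-Reasoning
  one : ∀ D → coeff 0ℚ [ 1ℚ ] D ≡ ι (δ D 0)
  one zero    = refl
  one (suc D) = refl

dyadic-scale : ∀ c k E → k ℕ.≤ E →
               ι (c ℤ.* + (2 ℕ.^ (E ∸ k))) ≡ (c ℚ./ (2 ℕ.^ k)) {{ℕP.m^n≢0 2 k}} ℚ.* ι (+ (2 ℕ.^ E))
dyadic-scale c k E k≤E = begin
  ι (c ℤ.* + (2 ℕ.^ (E ∸ k)))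
    ≡⟨ ι-* c _ ⟩
  ι c ℚ.* ι (+ (2 ℕ.^ (E ∸ k)))
    ≡⟨ cong (ℚ._* ι (+ (2 ℕ.^ (E ∸ k)))) (/-*-cancel c (2 ℕ.^ k) {{ℕP.m^n≢0 2 k}}) ⟨
  (q ℚ.* ι (+ (2 ℕ.^ k))) ℚ.* ι (+ (2 ℕ.^ (E ∸ k)))
    ≡⟨ ℚP.*-assoc q _ _ ⟩
  q ℚ.* (ι (+ (2 ℕ.^ k)) ℚ.* ι (+ (2 ℕ.^ (E ∸ k))))
    ≡⟨ cong (q ℚ.*_) (ι-* (+ (2 ℕ.^ k)) _) ⟨
  q ℚ.* ι (+ (2 ℕ.^ k) ℤ.* + (2 ℕ.^ (E ∸ k)))
    ≡⟨ cong (λ z → q ℚ.* ι z) 2^k*2^[E-k]≡2^E ⟩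
  q ℚ.* ι (+ (2 ℕ.^ E)) ∎
  where
  open ≡-Reasoning
  q = (c ℚ./ (2 ℕ.^ k)) {{ℕP.m^n≢0 2 k}}
  2^k*2^[E-k]≡2^E : + (2 ℕ.^ k) ℤ.* + (2 ℕ.^ (E ∸ k)) ≡ + (2 ℕ.^ E)
  2^k*2^[E-k]≡2^E = trans (sym (ℤP.pos-* (2 ℕ.^ k) _))
                          (cong +_ (trans (sym (ℕP.^-distribˡ-+-* 2 k (E ∸ k))) (cong (2 ℕ.^_) (ℕP.m+[n∸m]≡n k≤E))))

upperBound : ∀ k (h : ℕ → ℕ) → ∃ λ B → ∀ s → s ℕ.< k → h s ℕ.≤ B
upperBound zero    h = 0 , λ _ ()
upperBound (suc k) h with upperBound k (h ∘ suc)
... | B , bounded = h 0 ⊔ B , λ where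
  zero    _         → ℕP.m≤m⊔n (h 0) B
  (suc s) (s≤s s<k) → ℕP.≤-trans (bounded s s<k) (ℕP.m≤n⊔m (h 0) B)

clear-denominators : ∀ k (p : List ℚ) → AllDyadic p → ∃ λ B → ∀ E → B ℕ.≤ E →
                     ∃ λ (A : ℕ → ℤ) → ∀ s → s ℕ.< k → ι (A s) ≡ coeff 0ℚ p s ℚ.* ι (+ (2 ℕ.^ E))
clear-denominators k p dyadic with upperBound k (λ s → proj₁ (proj₂ (dyadic s)))
... | B , bounded = B , λ E B≤E →
  (λ s → numerator s ℤ.* + (2 ℕ.^ (E ∸ exponent s))) ,
  λ s s<k → trans (dyadic-scale (numerator s) (exponent s) E (ℕP.≤-trans (bounded s s<k) B≤E))
                  (cong (ℚ._* ι (+ (2 ℕ.^ E))) (sym (proj₂ (proj₂ (dyadic s)))))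
  where
  numerator = λ s → proj₁ (dyadic s)
  exponent = λ s → proj₁ (proj₂ (dyadic s))

resultant-constantʳ : ∀ {n} (f : MonicZ n) → resultant f [] ≡ + 1
resultant-constantʳ {n} f = trans (det-cong n (sylvester-constantʳ f)) (det-I n)

resultant-constantˡ : ∀ {m} (g : MonicZ m) → resultant [] g ≡ + 1
resultant-constantˡ {m} g = trans (det-cong (m ℕ.+ 0) (sylvester-constantˡ g)) (det-I (m ℕ.+ 0))

mainTheorem11 : ∀ {n m} (f : MonicZ n) (g : MonicZ m) →
    RelPrimeQ (toQ f) (toQ g) →
    (a : Vec ℚ m) (b : Vec ℚ n) →
    addQ (mulQ (vecQ a) (toQ f)) (mulQ (vecQ b) (toQ g)) ≈P [ 1ℚ ] →
    AllDyadic (vecQ a) → AllDyadic (vecQ b) →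
    DyadicallyResolve f g
mainTheorem11 {n}      {zero}   f  [] _ _ _ _ _ _ = 0 , inj₁ (resultant-constantʳ f)
mainTheorem11 {zero}   {suc m′} [] g  _ _ _ _ _ _ = 0 , inj₁ (resultant-constantˡ g)
mainTheorem11 {suc n′} {suc m′} f  g  _ a b bezout dyadic-a dyadic-b
  with clear-denominators (suc m′) (vecQ a) dyadic-a | clear-denominators (suc n′) (vecQ b) dyadic-b
... | Ba , scale-a | Bb , scale-b with scale-a (Ba ⊔ Bb) (ℕP.m≤m⊔n Ba Bb) | scale-b (Ba ⊔ Bb) (ℕP.m≤n⊔m Ba Bb)
... | A , ιA | B , ιB =
  det-±2^ N (T {c} (A , B) integral) (sylvester f g) E (T·sylvester {c} (A , B) integral)
  where
  open SylvesterRows f g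
  E = Ba ⊔ Bb
  c = + (2 ℕ.^ E)
  integral = integral-bezout f g a b bezout c A B ιA ιB
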